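{- Let $a,b\geq 0$ and $k\geq a+b+2$ be integers. Then \[ x\bigl(x^{k-a-b-2}\ \text{ш}\ y^b\bigr)y^{a+1}-x^{k-a-b-1}\bigl(x^b\ \text{ш}\ y^a\bigr)y\ \in\ \sum_{n\geq 1}\partial_n(x\,\mathfrak{h}\,y), \] where the right-hand side is the sum (as $\mathbb{Q}$-subspaces of $\mathfrak{h}$) of the images $\partial_n(x\mathfrak{h}y)$, $n\geq 1$.
   Context: Let $\mathfrak{h}=\mathbb{Q}\langle x,y\rangle$ be the noncommutative polynomial algebra over $\mathbb{Q}$ in two indeterminates $x,y$, and let $x\mathfrak{h}y$ denote the $\mathbb{Q}$-span of words beginning with $x$ and ending with $y$. The shuffle product $\text{ш}$ is the $\mathbb{Q}$-bilinear map $\mathfrak{h}\times\mathfrak{h}\to\mathfrak{h}$ defined by $1\ \text{ш}\ w=w\ \text{ш}\ 1=w$ and $uw\ \text{ш}\ vw'=u(w\ \text{ш}\ vw')+v(uw\ \text{ш}\ w')$ for letters $u,v\in\{x,y\}$ and words $w,w'$. Let $z=x+y$. For each $n\geq 1$, $\partial_n$ is the derivation of $\mathfrak{h}$ (a $\mathbb{Q}$-linear map with $\partial_n(ww')=\partial_n(w)w'+w\partial_n(w')$) determined by $\partial_n(x)=xz^{n-1}y$ and $\partial_n(y)=-xz^{n-1}y$. -}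

module Defs where

open import Data.Nat using (ℕ; zero; suc; _+_; _∸_; _≤_)
open import Data.Rational using (ℚ; 0ℚ; 1ℚ) renaming (_+_ to _+ℚ_; _*_ to _*ℚ_; -_ to -ℚ_)
open import Data.List using (List; []; _∷_; _++_; [_]; map; concatMap; foldr)
open import Data.Product using (_×_; _,_; ∃)
open import Relation.Binary.PropositionalEquality using (_≡_)
open import Relation.Nullary using (¬_; yes; no)
open import Relation.Binary using (DecidableEquality)
import Data.List.Properties as LP
open import Data.List.Relation.Unary.All using (All)

data Letter : Set where
  x y : Letter

_≟L_ : DecidableEquality Letter
x ≟L x = yes _≡_.refl
x ≟L y = no λ ()
y ≟L x = no λ ()
y ≟L y = yes _≡_.refl

Word : Set
Word = List Letter

_≟W_ : DecidableEquality Word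
_≟W_ = LP.≡-dec _≟L_

-- An element of 𝔥 = ℚ⟨x,y⟩, represented as a formal finite ℚ-linear combination of words.
Poly : Set
Poly = List (ℚ × Word)

coeff : Poly → Word → ℚ
coeff [] w = 0ℚ
coeff ((c , v) ∷ p) w with v ≟W w
... | yes _ = c +ℚ coeff p w
... | no  _ = coeff p w

_≈_ : Poly → Poly → Set
p ≈ q = ∀ w → coeff p w ≡ coeff q w

word : Word → Poly
word w = (1ℚ , w) ∷ []

_⊕_ : Poly → Poly → Poly
p ⊕ q = p ++ q

scale : ℚ → Poly → Poly
scale c p = map (λ { (d , w) → (c *ℚ d , w) }) p

_⊖_ : Poly → Poly → Poly
p ⊖ q = p ⊕ scale (-ℚ 1ℚ) q

_⊗_ : Poly → Poly → Poly
p ⊗ q = concatMap (λ { (c , v) → map (λ { (d , w) → (c *ℚ d , v ++ w) }) q }) p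

sumPoly : List Poly → Poly
sumPoly = foldr _⊕_ []

_◃_ : Letter → Poly → Poly
l ◃ p = map (λ { (c , w) → (c , l ∷ w) }) p

_ш_ : Word → Word → Poly
[] ш w' = word w'
(u ∷ w) ш [] = word (u ∷ w)
(u ∷ w) ш (v ∷ w') = (u ◃ (w ш (v ∷ w'))) ⊕ (v ◃ ((u ∷ w) ш w'))

pow : Letter → ℕ → Word
pow l zero = []
pow l (suc n) = l ∷ pow l n

-- z^m with z = x + y : sum of all words of length m
zpow : ℕ → Poly
zpow zero = word []
zpow (suc m) = (x ◃ zpow m) ⊕ (y ◃ zpow m)

-- ∂_n(x) = x z^{n-1} y  (used for n ≥ 1)
dgen : ℕ → Poly
dgen n = word [ x ] ⊗ (zpow (n ∸ 1) ⊗ word [ y ])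

∂L : ℕ → Letter → Poly
∂L n x = dgen n
∂L n y = scale (-ℚ 1ℚ) (dgen n)

∂W : ℕ → Word → Poly
∂W n [] = []
∂W n (l ∷ w) = (∂L n l ⊗ word w) ⊕ (l ◃ ∂W n w)

∂ : ℕ → Poly → Poly
∂ n p = concatMap (λ { (c , w) → scale c (∂W n w) }) p

XWordY : Word → Set
XWordY w = ∃ λ v → w ≡ x ∷ (v ++ [ y ])

InXhY : Poly → Set
InXhY u = ∀ w → ¬ XWordY w → coeff u w ≡ 0ℚ

InSumImages : Poly → Set
InSumImages p =
  ∃ λ (L : List (ℕ × Poly)) →
    All (λ { (n , u) → (1 ≤ n) × InXhY u }) L
    × (p ≈ sumPoly (map (λ { (n , u) → ∂ n u }) L))

target : ℕ → ℕ → ℕ → Poly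
target a b k =
  (word [ x ] ⊗ ((pow x (k ∸ (a + b + 2)) ш pow y b) ⊗ word (pow y (a + 1))))
  ⊖ (word (pow x (k ∸ (a + b + 1))) ⊗ ((pow x b ш pow y a) ⊗ word [ y ]))

-- Let Φₜ be the algebra endomorphism of 𝔥[[t]] with Φₜ(x) = x (1 - t y)⁻¹ and Φₜ(y) = z - Φₜ(x).
-- Both t d/dt and D = ∑ₙ tⁿ ∂ₙ are derivations, and they agree on Φₜ(x) and Φₜ(y); hence
-- t d/dt Φₜ(w) = D Φₜ(w) for every word w. Comparing coefficients of tʲ⁺¹ writes (j + 1) Φⱼ₊₁(w)
-- as a sum of elements ∂ₙ(Φₖ(w)), and Φₖ preserves x𝔥y, so Φⱼ₊₁(x𝔥y) ⊆ ∑ₙ ∂ₙ(x𝔥y).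
-- The series Gₐ = ∑_c (xᶜ ш yᵃ) y tᶜ satisfies Gₐ = t x Gₐ + y Gₐ₋₁ (with G₋₁ = 1), which forces
-- Φₜ(Gₐ) = yᵃ⁺¹. Hence Φₜ(xᵐ⁺¹ Gₐ) = Φₜ(x)ᵐ⁺¹ yᵃ⁺¹ has tᵇ-coefficient x (xᵐ ш yᵇ) yᵃ⁺¹; removing
-- its Φ₀-part xᵐ⁺¹ (xᵇ ш yᵃ) y leaves ∑_{j ≥ 1} Φⱼ(xᵐ⁺¹ (xᵇ⁻ʲ ш yᵃ) y), which for m = k - a - b - 2
-- is the element of the theorem.

module Submission where

open import Defs
open import Data.Nat as N using (ℕ; zero; suc; s≤s; z≤n; _∸_)
open import Data.Nat.Induction using (<-rec)
import Data.Nat.Properties as NP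
open import Data.Rational using (ℚ; 0ℚ; 1ℚ; _+_; _*_; -_; 1/_; NonZero; NonNegative)
import Data.Rational.Properties as QP
open import Data.Rational.Solver using (module +-*-Solver)
open +-*-Solver using (solve; _:+_; _:*_; _:=_; con)
open import Data.List using (List; []; _∷_; _++_; [_]; map; length)
import Data.List.Properties as LP
open import Data.List.Relation.Unary.All as All using (All; []; _∷_)
import Data.List.Relation.Unary.All.Properties as All
open import Data.Product using (_×_; _,_; proj₂; ∃)
open import Data.Unit using (⊤; tt)
open import Data.Empty using (⊥-elim)
open import Relation.Nullary using (yes; no)
open import Relation.Binary.PropositionalEquality hiding ([_])
open import Relation.Binary using (Setoid)
import Relation.Binary.Reasoning.Setoid as SetoidReasoning

-- A record around the pointwise equality _≈_ of Defs, so that its arguments can be inferred.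
infix 4 _≋_
record _≋_ (p q : Poly) : Set where
  constructor mk
  field get : p ≈ q
open _≋_ public

≋-refl : ∀ {p} → p ≋ p
≋-refl = mk λ w → refl

≋-sym : ∀ {p q} → p ≋ q → q ≋ p
≋-sym e = mk λ w → sym (get e w)

≋-trans : ∀ {p q r} → p ≋ q → q ≋ r → p ≋ r
≋-trans e f = mk λ w → trans (get e w) (get f w)

≡⇒≋ : ∀ {p q} → p ≡ q → p ≋ q
≡⇒≋ refl = ≋-refl

≋-setoid : Setoid _ _
≋-setoid = record
  { Carrier = Poly
  ; _≈_ = _≋_
  ; isEquivalence = record { refl = ≋-refl ; sym = ≋-sym ; trans = ≋-trans }
  }

open SetoidReasoning ≋-setoid

coeff-⊕ : ∀ p q w → coeff (p ⊕ q) w ≡ coeff p w + coeff q w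
coeff-⊕ [] q w = sym (QP.+-identityˡ _)
coeff-⊕ ((c , v) ∷ p) q w with v ≟W w
... | yes _ = trans (cong (c +_) (coeff-⊕ p q w)) (sym (QP.+-assoc c _ _))
... | no _ = coeff-⊕ p q w

coeff-scale : ∀ c p w → coeff (scale c p) w ≡ c * coeff p w
coeff-scale c [] w = sym (QP.*-zeroʳ c)
coeff-scale c ((d , v) ∷ p) w with v ≟W w
... | yes _ = trans (cong ((c * d) +_) (coeff-scale c p w)) (sym (QP.*-distribˡ-+ c d _))
... | no _ = coeff-scale c p w

coeff-⊖ : ∀ p q w → coeff (p ⊖ q) w ≡ coeff p w + (- 1ℚ) * coeff q w
coeff-⊖ p q w = trans (coeff-⊕ p _ w) (cong (coeff p w +_) (coeff-scale (- 1ℚ) q w))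

∷-cong : ∀ {c c′ w p p′} → c ≡ c′ → p ≋ p′ → ((c , w) ∷ p) ≋ ((c′ , w) ∷ p′)
∷-cong {c} {w = w} {p} {p′} refl e = mk coeffs
  where
  coeffs : ∀ u → coeff ((c , w) ∷ p) u ≡ coeff ((c , w) ∷ p′) u
  coeffs u with w ≟W u
  ... | yes _ = cong (c +_) (get e u)
  ... | no _ = get e u

⊕-cong : ∀ {p p′ q q′} → p ≋ p′ → q ≋ q′ → (p ⊕ q) ≋ (p′ ⊕ q′)
⊕-cong {p} {p′} {q} {q′} e f = mk λ w →
  trans (coeff-⊕ p q w) (trans (cong₂ _+_ (get e w) (get f w)) (sym (coeff-⊕ p′ q′ w)))

⊕-congˡ : ∀ {p p′} q → p ≋ p′ → (p ⊕ q) ≋ (p′ ⊕ q)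
⊕-congˡ q e = ⊕-cong e ≋-refl

⊕-congʳ : ∀ p {q q′} → q ≋ q′ → (p ⊕ q) ≋ (p ⊕ q′)
⊕-congʳ p e = ⊕-cong ≋-refl e

⊕-comm : ∀ p q → (p ⊕ q) ≋ (q ⊕ p)
⊕-comm p q = mk λ w →
  trans (coeff-⊕ p q w) (trans (QP.+-comm (coeff p w) (coeff q w)) (sym (coeff-⊕ q p w)))

⊕-assoc : ∀ p q r → ((p ⊕ q) ⊕ r) ≋ (p ⊕ (q ⊕ r))
⊕-assoc p q r = ≡⇒≋ (LP.++-assoc p q r)

⊕-identityʳ : ∀ p → (p ⊕ []) ≋ p
⊕-identityʳ p = ≡⇒≋ (LP.++-identityʳ p)

⊕-swap : ∀ p q r → (p ⊕ (q ⊕ r)) ≋ (q ⊕ (p ⊕ r))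
⊕-swap p q r = begin
  p ⊕ (q ⊕ r)  ≈⟨ ⊕-assoc p q r ⟨
  (p ⊕ q) ⊕ r  ≈⟨ ⊕-congˡ r (⊕-comm p q) ⟩
  (q ⊕ p) ⊕ r  ≈⟨ ⊕-assoc q p r ⟩
  q ⊕ (p ⊕ r)  ∎

⊕-interchange : ∀ p q r s → ((p ⊕ q) ⊕ (r ⊕ s)) ≋ ((p ⊕ r) ⊕ (q ⊕ s))
⊕-interchange p q r s = begin
  (p ⊕ q) ⊕ (r ⊕ s)  ≈⟨ ⊕-assoc p q (r ⊕ s) ⟩
  p ⊕ (q ⊕ (r ⊕ s))  ≈⟨ ⊕-congʳ p (⊕-swap q r s) ⟩
  p ⊕ (r ⊕ (q ⊕ s))  ≈⟨ ⊕-assoc p r (q ⊕ s) ⟨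
  (p ⊕ r) ⊕ (q ⊕ s)  ∎

scale-cong : ∀ c {p q} → p ≋ q → scale c p ≋ scale c q
scale-cong c {p} {q} e = mk λ w →
  trans (coeff-scale c p w) (trans (cong (c *_) (get e w)) (sym (coeff-scale c q w)))

scale-⊕ : ∀ c p q → scale c (p ⊕ q) ≡ (scale c p ⊕ scale c q)
scale-⊕ c p q = LP.map-++ _ p q

scale-scale : ∀ c d p → scale c (scale d p) ≋ scale (c * d) p
scale-scale c d p = mk coeffs
  where
  coeffs : ∀ w → coeff (scale c (scale d p)) w ≡ coeff (scale (c * d) p) w
  coeffs w = trans (coeff-scale c (scale d p) w) (trans (cong (c *_) (coeff-scale d p w))
    (trans (sym (QP.*-assoc c d (coeff p w))) (sym (coeff-scale (c * d) p w))))

scale-comm : ∀ c d p → scale c (scale d p) ≋ scale d (scale c p)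
scale-comm c d p =
  ≋-trans (scale-scale c d p) (≋-trans (≡⇒≋ (cong (λ e → scale e p) (QP.*-comm c d))) (≋-sym (scale-scale d c p)))

scale-1ℚ : ∀ p → scale 1ℚ p ≋ p
scale-1ℚ p = mk λ w → trans (coeff-scale 1ℚ p w) (QP.*-identityˡ _)

⊖-null : ∀ {p q} → p ≋ q → (p ⊖ q) ≋ []
⊖-null {p} {q} e = mk λ w → trans (coeff-⊖ p q w)
  (trans (cong (λ t → t + (- 1ℚ) * coeff q w) (get e w))
    (solve 1 (λ a → a :+ con (- 1ℚ) :* a := con 0ℚ) refl (coeff q w)))

⊕-⊖-cancelˡ : ∀ p q → ((p ⊕ q) ⊖ p) ≋ q
⊕-⊖-cancelˡ p q = mk λ w → trans (coeff-⊖ (p ⊕ q) p w)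
  (trans (cong (λ t → t + (- 1ℚ) * coeff p w) (coeff-⊕ p q w))
    (solve 2 (λ a b → (a :+ b) :+ con (- 1ℚ) :* a := b) refl (coeff p w) (coeff q w)))

⊖-⊕-cancel : ∀ p q r → ((p ⊖ q) ⊕ (r ⊕ q)) ≋ (r ⊕ p)
⊖-⊕-cancel p q r = mk coeffs
  where
  coeffs : ∀ w → coeff ((p ⊖ q) ⊕ (r ⊕ q)) w ≡ coeff (r ⊕ p) w
  coeffs w = trans (coeff-⊕ (p ⊖ q) (r ⊕ q) w)
    (trans (cong₂ _+_ (coeff-⊖ p q w) (coeff-⊕ r q w))
      (trans (solve 3 (λ a b c → (a :+ con (- 1ℚ) :* b) :+ (c :+ b) := c :+ a) refl (coeff p w) (coeff q w) (coeff r w))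
        (sym (coeff-⊕ r p w))))

-- A Poly may repeat words, so maps defined termwise must be shown to respect ≋;
-- it suffices to do so for the functionals ∑ cᵢ wᵢ ↦ ∑ cᵢ g(wᵢ).
pairing : (Word → ℚ) → Poly → ℚ
pairing g [] = 0ℚ
pairing g ((c , v) ∷ p) = c * g v + pairing g p

pairing-++ : ∀ g p q → pairing g (p ++ q) ≡ pairing g p + pairing g q
pairing-++ g [] q = sym (QP.+-identityˡ _)
pairing-++ g ((c , v) ∷ p) q =
  trans (cong (c * g v +_) (pairing-++ g p q)) (sym (QP.+-assoc (c * g v) (pairing g p) (pairing g q)))

pairing-scale : ∀ g c p → pairing g (scale c p) ≡ c * pairing g p
pairing-scale g c [] = sym (QP.*-zeroʳ c)
pairing-scale g c ((d , v) ∷ p) = trans (cong (c * d * g v +_) (pairing-scale g c p))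
  (solve 4 (λ c d a e → c :* d :* a :+ c :* e := c :* (d :* a :+ e)) refl c d (g v) (pairing g p))

removeWord : Word → Poly → Poly
removeWord v [] = []
removeWord v ((c , u) ∷ p) with u ≟W v
... | yes _ = removeWord v p
... | no _ = (c , u) ∷ removeWord v p

pairing-removeWord : ∀ g v p → pairing g p ≡ coeff p v * g v + pairing g (removeWord v p)
pairing-removeWord g v [] = sym (trans (cong (_+ 0ℚ) (QP.*-zeroˡ (g v))) (QP.+-identityˡ 0ℚ))
pairing-removeWord g v ((c , u) ∷ p) with u ≟W v
... | yes refl = trans (cong (c * g u +_) (pairing-removeWord g v p))
  (solve 4 (λ c a b e → c :* a :+ (b :* a :+ e) := (c :+ b) :* a :+ e) refl c (g u) (coeff p v) (pairing g (removeWord v p)))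
... | no _ = trans (cong (c * g u +_) (pairing-removeWord g v p))
  (solve 4 (λ x b a e → x :+ (b :* a :+ e) := b :* a :+ (x :+ e)) refl (c * g u) (coeff p v) (g v) (pairing g (removeWord v p)))

coeff-removeWord-same : ∀ v p → coeff (removeWord v p) v ≡ 0ℚ
coeff-removeWord-same v [] = refl
coeff-removeWord-same v ((c , u) ∷ p) with u ≟W v
... | yes _ = coeff-removeWord-same v p
... | no u≢v with u ≟W v
...   | yes u≡v = ⊥-elim (u≢v u≡v)
...   | no _ = coeff-removeWord-same v p

coeff-removeWord-other : ∀ v w p → v ≢ w → coeff (removeWord v p) w ≡ coeff p w
coeff-removeWord-other v w [] _ = refl
coeff-removeWord-other v w ((c , u) ∷ p) v≢w with u ≟W v
... | yes refl with u ≟W w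
...   | yes refl = ⊥-elim (v≢w refl)
...   | no _ = coeff-removeWord-other v w p v≢w
coeff-removeWord-other v w ((c , u) ∷ p) v≢w | no _ with u ≟W w
...   | yes _ = cong (c +_) (coeff-removeWord-other v w p v≢w)
...   | no _ = coeff-removeWord-other v w p v≢w

removeWord-null : ∀ v {p} → p ≋ [] → removeWord v p ≋ []
removeWord-null v {p} p≋[] = mk coeffs
  where
  coeffs : ∀ w → coeff (removeWord v p) w ≡ 0ℚ
  coeffs w with v ≟W w
  ... | yes refl = coeff-removeWord-same v p
  ... | no v≢w = trans (coeff-removeWord-other v w p v≢w) (get p≋[] w)

length-removeWord : ∀ v p → length (removeWord v p) N.≤ length p
length-removeWord v [] = z≤n
length-removeWord v ((c , u) ∷ p) with u ≟W v
... | yes _ = NP.m≤n⇒m≤1+n (length-removeWord v p)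
... | no _ = s≤s (length-removeWord v p)

removeWord-head : ∀ c v p → removeWord v ((c , v) ∷ p) ≡ removeWord v p
removeWord-head c v p with v ≟W v
... | yes _ = refl
... | no v≢v = ⊥-elim (v≢v refl)

-- Induction on the number of terms: the head word has total coefficient 0, so it can be removed.
pairing-null : ∀ g p → p ≋ [] → pairing g p ≡ 0ℚ
pairing-null g p = bounded (length p) p NP.≤-refl
  where
  bounded : ∀ n p → length p N.≤ n → p ≋ [] → pairing g p ≡ 0ℚ
  bounded n [] _ _ = refl
  bounded (suc n) ((c , v) ∷ p) (s≤s |p|≤n) p≋[] = pairing≡0
    where
    rest : Poly
    rest = removeWord v ((c , v) ∷ p)
    |rest|≤n : length rest N.≤ n
    |rest|≤n = subst (λ r → length r N.≤ n) (sym (removeWord-head c v p)) (NP.≤-trans (length-removeWord v p) |p|≤n)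
    pairing≡0 : pairing g ((c , v) ∷ p) ≡ 0ℚ
    pairing≡0 = trans (pairing-removeWord g v ((c , v) ∷ p))
      (trans (cong₂ (λ a b → a * g v + b) (get p≋[] v) (bounded n rest |rest|≤n (removeWord-null v p≋[])))
        (trans (cong (_+ 0ℚ) (QP.*-zeroˡ (g v))) (QP.+-identityˡ 0ℚ)))

difference-null⇒≡ : ∀ a b → a + (- 1ℚ) * b ≡ 0ℚ → a ≡ b
difference-null⇒≡ a b e = trans (solve 2 (λ a b → a := (a :+ con (- 1ℚ) :* b) :+ b) refl a b)
  (trans (cong (_+ b) e) (QP.+-identityˡ b))

pairing-cong : ∀ g {p q} → p ≋ q → pairing g p ≡ pairing g q
pairing-cong g {p} {q} e = difference-null⇒≡ (pairing g p) (pairing g q)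
  (trans (sym (trans (pairing-++ g p _) (cong (pairing g p +_) (pairing-scale g (- 1ℚ) q))))
    (pairing-null g (p ⊖ q) (⊖-null e)))

lin : (Word → Poly) → Poly → Poly
lin f [] = []
lin f ((c , w) ∷ p) = scale c (f w) ⊕ lin f p

coeff-lin : ∀ f p u → coeff (lin f p) u ≡ pairing (λ v → coeff (f v) u) p
coeff-lin f [] u = refl
coeff-lin f ((c , w) ∷ p) u = trans (coeff-⊕ (scale c (f w)) _ u)
  (cong₂ _+_ (coeff-scale c (f w) u) (coeff-lin f p u))

lin-cong : ∀ f {p q} → p ≋ q → lin f p ≋ lin f q
lin-cong f {p} {q} e = mk λ u → trans (coeff-lin f p u) (trans (pairing-cong _ e) (sym (coeff-lin f q u)))

lin-cong∘ : ∀ {f g} p → (∀ w → f w ≋ g w) → lin f p ≋ lin g p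
lin-cong∘ [] e = ≋-refl
lin-cong∘ ((c , w) ∷ p) e = ⊕-cong (scale-cong c (e w)) (lin-cong∘ p e)

lin-++ : ∀ f p q → lin f (p ++ q) ≡ (lin f p ⊕ lin f q)
lin-++ f [] q = refl
lin-++ f ((c , w) ∷ p) q = trans (cong (scale c (f w) ++_) (lin-++ f p q)) (sym (LP.++-assoc (scale c (f w)) _ _))

lin-scale : ∀ f c p → lin f (scale c p) ≋ scale c (lin f p)
lin-scale f c [] = ≋-refl
lin-scale f c ((d , w) ∷ p) = begin
  (scale (c * d) (f w) ⊕ lin f (scale c p))
    ≈⟨ ⊕-cong (≋-sym (scale-scale c d (f w))) (lin-scale f c p) ⟩
  (scale c (scale d (f w)) ⊕ scale c (lin f p))
    ≈⟨ ≡⇒≋ (sym (scale-⊕ c (scale d (f w)) (lin f p))) ⟩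
  scale c (scale d (f w) ⊕ lin f p) ∎

lin-word : ∀ f w → lin f (word w) ≋ f w
lin-word f w = ≋-trans (⊕-identityʳ _) (scale-1ℚ (f w))

lin-⊕∘ : ∀ f g p → lin (λ w → f w ⊕ g w) p ≋ (lin f p ⊕ lin g p)
lin-⊕∘ f g [] = ≋-refl
lin-⊕∘ f g ((c , w) ∷ p) = begin
  (scale c (f w ⊕ g w) ⊕ lin (λ w → f w ⊕ g w) p)
    ≈⟨ ⊕-cong (≡⇒≋ (scale-⊕ c (f w) (g w))) (lin-⊕∘ f g p) ⟩
  ((scale c (f w) ⊕ scale c (g w)) ⊕ (lin f p ⊕ lin g p))
    ≈⟨ ⊕-interchange (scale c (f w)) (scale c (g w)) (lin f p) (lin g p) ⟩
  ((scale c (f w) ⊕ lin f p) ⊕ (scale c (g w) ⊕ lin g p)) ∎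

lin-scale∘ : ∀ f c p → lin (λ w → scale c (f w)) p ≋ scale c (lin f p)
lin-scale∘ f c [] = ≋-refl
lin-scale∘ f c ((d , w) ∷ p) = begin
  scale d (scale c (f w)) ⊕ lin (λ w → scale c (f w)) p  ≈⟨ ⊕-cong (scale-comm d c (f w)) (lin-scale∘ f c p) ⟩
  scale c (scale d (f w)) ⊕ scale c (lin f p)            ≈⟨ ≡⇒≋ (scale-⊕ c (scale d (f w)) (lin f p)) ⟨
  scale c (scale d (f w) ⊕ lin f p)                      ∎

lin-lin : ∀ f g p → lin g (lin f p) ≋ lin (λ w → lin g (f w)) p
lin-lin f g [] = ≋-refl
lin-lin f g ((c , w) ∷ p) = begin
  lin g (scale c (f w) ⊕ lin f p)
    ≈⟨ ≡⇒≋ (lin-++ g (scale c (f w)) (lin f p)) ⟩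
  (lin g (scale c (f w)) ⊕ lin g (lin f p))
    ≈⟨ ⊕-cong (lin-scale g c (f w)) (lin-lin f g p) ⟩
  (scale c (lin g (f w)) ⊕ lin (λ w → lin g (f w)) p) ∎

lin-zero : ∀ p → lin (λ _ → []) p ≋ []
lin-zero [] = ≋-refl
lin-zero ((c , w) ∷ p) = lin-zero p

lin-id : ∀ p → lin word p ≋ p
lin-id [] = ≋-refl
lin-id ((c , w) ∷ p) = ∷-cong (QP.*-identityʳ c) (lin-id p)

lin-swap : ∀ (h : Word → Word → Poly) p q → lin (λ v → lin (λ w → h v w) q) p ≋ lin (λ w → lin (λ v → h v w) p) q
lin-swap h [] q = ≋-sym (lin-zero q)
lin-swap h ((c , v) ∷ p) q = begin
  (scale c (lin (h v) q) ⊕ lin (λ v → lin (λ w → h v w) q) p)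
    ≈⟨ ⊕-cong (≋-sym (lin-scale∘ (h v) c q)) (lin-swap h p q) ⟩
  (lin (λ w → scale c (h v w)) q ⊕ lin (λ w → lin (λ v → h v w) p) q)
    ≈⟨ ≋-sym (lin-⊕∘ (λ w → scale c (h v w)) (λ w → lin (λ v → h v w) p) q) ⟩
  lin (λ w → lin (λ v → h v w) ((c , v) ∷ p)) q ∎

prefix : Word → Poly → Poly
prefix v q = map (λ { (d , w) → (d , v ++ w) }) q

prefix-lin : ∀ v q → prefix v q ≋ lin (λ w → word (v ++ w)) q
prefix-lin v [] = ≋-refl
prefix-lin v ((d , w) ∷ q) = ∷-cong (sym (QP.*-identityʳ d)) (prefix-lin v q)

prefix-cong : ∀ v {q q'} → q ≋ q' → prefix v q ≋ prefix v q'
prefix-cong v {q} {q'} e = ≋-trans (prefix-lin v q)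
  (≋-trans (lin-cong (λ w → word (v ++ w)) e) (≋-sym (prefix-lin v q')))

prefix-prefix : ∀ v w r → prefix v (prefix w r) ≡ prefix (v ++ w) r
prefix-prefix v w r = trans (sym (LP.map-∘ r)) (LP.map-cong (λ { (d , u) → cong (d ,_) (sym (LP.++-assoc v w u)) }) r)

prefix-⊕ : ∀ v p q → prefix v (p ⊕ q) ≡ (prefix v p ⊕ prefix v q)
prefix-⊕ v p q = LP.map-++ _ p q

prefix-scale : ∀ v c p → prefix v (scale c p) ≡ scale c (prefix v p)
prefix-scale v c p = trans (sym (LP.map-∘ p)) (trans (LP.map-cong (λ _ → refl) p) (LP.map-∘ p))

prefix-[] : ∀ p → prefix [] p ≡ p
prefix-[] p = trans (LP.map-cong (λ _ → refl) p) (LP.map-id p)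

◃-prefix : ∀ l p → l ◃ p ≡ prefix [ l ] p
◃-prefix l p = LP.map-cong (λ _ → refl) p

prefix-lin∘ : ∀ v f p → prefix v (lin f p) ≋ lin (λ w → prefix v (f w)) p
prefix-lin∘ v f [] = ≋-refl
prefix-lin∘ v f ((c , w) ∷ p) = ≋-trans (≡⇒≋ (prefix-⊕ v (scale c (f w)) (lin f p)))
  (⊕-cong (≡⇒≋ (prefix-scale v c (f w))) (prefix-lin∘ v f p))

⊗-lin : ∀ p q → (p ⊗ q) ≡ lin (λ v → prefix v q) p
⊗-lin [] q = refl
⊗-lin ((c , v) ∷ p) q = cong₂ _++_ (trans (LP.map-cong (λ _ → refl) q) (LP.map-∘ q)) (⊗-lin p q)

⊗-congˡ : ∀ {p p'} q → p ≋ p' → (p ⊗ q) ≋ (p' ⊗ q)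
⊗-congˡ {p} {p'} q e = ≋-trans (≡⇒≋ (⊗-lin p q)) (≋-trans (lin-cong (λ v → prefix v q) e) (≡⇒≋ (sym (⊗-lin p' q))))

⊗-congʳ : ∀ p {q q'} → q ≋ q' → (p ⊗ q) ≋ (p ⊗ q')
⊗-congʳ p {q} {q'} e = ≋-trans (≡⇒≋ (⊗-lin p q))
  (≋-trans (lin-cong∘ p (λ v → prefix-cong v e)) (≡⇒≋ (sym (⊗-lin p q'))))

⊗-cong : ∀ {p p' q q'} → p ≋ p' → q ≋ q' → (p ⊗ q) ≋ (p' ⊗ q')
⊗-cong {p} {p'} {q} {q'} e f = ≋-trans (⊗-congˡ q e) (⊗-congʳ p' f)

⊗-⊕ˡ : ∀ p p' q → ((p ⊕ p') ⊗ q) ≋ ((p ⊗ q) ⊕ (p' ⊗ q))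
⊗-⊕ˡ p p' q = ≡⇒≋ (trans (⊗-lin (p ⊕ p') q) (trans (lin-++ _ p p') (sym (cong₂ _++_ (⊗-lin p q) (⊗-lin p' q)))))

⊗-⊕ʳ : ∀ p q q' → (p ⊗ (q ⊕ q')) ≋ ((p ⊗ q) ⊕ (p ⊗ q'))
⊗-⊕ʳ p q q' = begin
  (p ⊗ (q ⊕ q'))
    ≈⟨ ≡⇒≋ (⊗-lin p _) ⟩
  lin (λ v → prefix v (q ⊕ q')) p
    ≈⟨ lin-cong∘ p (λ v → ≡⇒≋ (prefix-⊕ v q q')) ⟩
  lin (λ v → prefix v q ⊕ prefix v q') p
    ≈⟨ lin-⊕∘ (λ v → prefix v q) (λ v → prefix v q') p ⟩
  (lin (λ v → prefix v q) p ⊕ lin (λ v → prefix v q') p)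
    ≈⟨ ≡⇒≋ (sym (cong₂ _++_ (⊗-lin p q) (⊗-lin p q'))) ⟩
  ((p ⊗ q) ⊕ (p ⊗ q')) ∎

⊗-scaleˡ : ∀ c p q → (scale c p ⊗ q) ≋ scale c (p ⊗ q)
⊗-scaleˡ c p q = ≋-trans (≡⇒≋ (⊗-lin (scale c p) q))
  (≋-trans (lin-scale (λ v → prefix v q) c p) (scale-cong c (≡⇒≋ (sym (⊗-lin p q)))))

⊗-scaleʳ : ∀ c p q → (p ⊗ scale c q) ≋ scale c (p ⊗ q)
⊗-scaleʳ c p q = begin
  (p ⊗ scale c q)
    ≈⟨ ≡⇒≋ (⊗-lin p _) ⟩
  lin (λ v → prefix v (scale c q)) p
    ≈⟨ lin-cong∘ p (λ v → ≡⇒≋ (prefix-scale v c q)) ⟩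
  lin (λ v → scale c (prefix v q)) p
    ≈⟨ lin-scale∘ (λ v → prefix v q) c p ⟩
  scale c (lin (λ v → prefix v q) p)
    ≈⟨ scale-cong c (≡⇒≋ (sym (⊗-lin p q))) ⟩
  scale c (p ⊗ q) ∎

⊗-[]ʳ : ∀ p → (p ⊗ []) ≋ []
⊗-[]ʳ p = ≋-trans (≡⇒≋ (⊗-lin p [])) (lin-zero p)

word-⊗ : ∀ u q → (word u ⊗ q) ≋ prefix u q
word-⊗ u q = ≋-trans (≡⇒≋ (⊗-lin (word u) q)) (lin-word (λ v → prefix v q) u)

⊗-word[] : ∀ p → (p ⊗ word []) ≋ p
⊗-word[] p = begin
  p ⊗ word []                     ≈⟨ ≡⇒≋ (⊗-lin p (word [])) ⟩
  lin (λ v → word (v ++ [])) p    ≈⟨ lin-cong∘ p (λ v → ≡⇒≋ (cong word (LP.++-identityʳ v))) ⟩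
  lin word p                      ≈⟨ lin-id p ⟩
  p                               ∎

⊗-lin∘ˡ : ∀ f p q → (lin f p ⊗ q) ≋ lin (λ w → f w ⊗ q) p
⊗-lin∘ˡ f p q = ≋-trans (≡⇒≋ (⊗-lin (lin f p) q))
  (≋-trans (lin-lin f (λ v → prefix v q) p) (lin-cong∘ p (λ w → ≡⇒≋ (sym (⊗-lin (f w) q)))))

⊗-lin∘ʳ : ∀ p f q → (p ⊗ lin f q) ≋ lin (λ w → p ⊗ f w) q
⊗-lin∘ʳ p f q = begin
  p ⊗ lin f q                                     ≈⟨ ≡⇒≋ (⊗-lin p (lin f q)) ⟩
  lin (λ v → prefix v (lin f q)) p                ≈⟨ lin-cong∘ p (λ v → prefix-lin∘ v f q) ⟩
  lin (λ v → lin (λ w → prefix v (f w)) q) p      ≈⟨ lin-swap (λ v w → prefix v (f w)) p q ⟩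
  lin (λ w → lin (λ v → prefix v (f w)) p) q      ≈⟨ lin-cong∘ q (λ w → ≡⇒≋ (sym (⊗-lin p (f w)))) ⟩
  lin (λ w → p ⊗ f w) q                           ∎

⊗-word-lin : ∀ p q → lin (λ w → p ⊗ word w) q ≋ (p ⊗ q)
⊗-word-lin p q = ≋-sym (≋-trans (⊗-congʳ p (≋-sym (lin-id q))) (⊗-lin∘ʳ p word q))

prefix-⊗ : ∀ v q r → (prefix v q ⊗ r) ≋ prefix v (q ⊗ r)
prefix-⊗ v q r = begin
  prefix v q ⊗ r
    ≈⟨ ⊗-congˡ r (prefix-lin v q) ⟩
  lin (λ w → word (v ++ w)) q ⊗ r
    ≈⟨ ⊗-lin∘ˡ (λ w → word (v ++ w)) q r ⟩
  lin (λ w → word (v ++ w) ⊗ r) q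
    ≈⟨ lin-cong∘ q (λ w → ≋-trans (word-⊗ (v ++ w) r) (≡⇒≋ (sym (prefix-prefix v w r)))) ⟩
  lin (λ w → prefix v (prefix w r)) q
    ≈⟨ prefix-lin∘ v (λ w → prefix w r) q ⟨
  prefix v (lin (λ w → prefix w r) q)
    ≈⟨ ≡⇒≋ (cong (prefix v) (⊗-lin q r)) ⟨
  prefix v (q ⊗ r) ∎

⊗-assoc : ∀ p q r → ((p ⊗ q) ⊗ r) ≋ (p ⊗ (q ⊗ r))
⊗-assoc p q r = begin
  (p ⊗ q) ⊗ r                     ≈⟨ ≋-trans (⊗-congˡ r (≡⇒≋ (⊗-lin p q))) (⊗-lin∘ˡ (λ v → prefix v q) p r) ⟩
  lin (λ v → prefix v q ⊗ r) p    ≈⟨ lin-cong∘ p (λ v → prefix-⊗ v q r) ⟩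
  lin (λ v → prefix v (q ⊗ r)) p  ≈⟨ ≡⇒≋ (⊗-lin p (q ⊗ r)) ⟨
  p ⊗ (q ⊗ r)                     ∎

word-++ : ∀ u v → word (u ++ v) ≋ (word u ⊗ word v)
word-++ u v = ≋-sym (word-⊗ u (word v))

◃-⊗ : ∀ l p q → (l ◃ (p ⊗ q)) ≋ ((l ◃ p) ⊗ q)
◃-⊗ l p q = begin
  (l ◃ (p ⊗ q))
    ≈⟨ ≡⇒≋ (◃-prefix l (p ⊗ q)) ⟩
  prefix [ l ] (p ⊗ q)
    ≈⟨ ≋-sym (word-⊗ [ l ] (p ⊗ q)) ⟩
  (word [ l ] ⊗ (p ⊗ q))
    ≈⟨ ≋-sym (⊗-assoc (word [ l ]) p q) ⟩
  ((word [ l ] ⊗ p) ⊗ q)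
    ≈⟨ ⊗-congˡ q (≋-trans (word-⊗ [ l ] p) (≡⇒≋ (sym (◃-prefix l p)))) ⟩
  ((l ◃ p) ⊗ q) ∎

∂-lin : ∀ n p → ∂ n p ≡ lin (∂W n) p
∂-lin n [] = refl
∂-lin n ((c , w) ∷ p) = cong (scale c (∂W n w) ++_) (∂-lin n p)

∂-cong : ∀ n {p q} → p ≋ q → ∂ n p ≋ ∂ n q
∂-cong n {p} {q} e = ≋-trans (≡⇒≋ (∂-lin n p)) (≋-trans (lin-cong (∂W n) e) (≡⇒≋ (sym (∂-lin n q))))

∂-⊕ : ∀ n p q → ∂ n (p ⊕ q) ≋ (∂ n p ⊕ ∂ n q)
∂-⊕ n p q = ≡⇒≋ (trans (∂-lin n (p ⊕ q)) (trans (lin-++ (∂W n) p q) (sym (cong₂ _++_ (∂-lin n p) (∂-lin n q)))))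

∂-scale : ∀ n c p → ∂ n (scale c p) ≋ scale c (∂ n p)
∂-scale n c p = ≋-trans (≡⇒≋ (∂-lin n (scale c p)))
  (≋-trans (lin-scale (∂W n) c p) (scale-cong c (≡⇒≋ (sym (∂-lin n p)))))

∂-word : ∀ n w → ∂ n (word w) ≋ ∂W n w
∂-word n w = ≋-trans (≡⇒≋ (∂-lin n (word w))) (lin-word (∂W n) w)

∂-lin∘ : ∀ n f p → ∂ n (lin f p) ≋ lin (λ w → ∂ n (f w)) p
∂-lin∘ n f p = ≋-trans (≡⇒≋ (∂-lin n (lin f p)))
  (≋-trans (lin-lin f (∂W n) p) (lin-cong∘ p (λ w → ≡⇒≋ (sym (∂-lin n (f w))))))

∂W-++ : ∀ n u v → ∂W n (u ++ v) ≋ ((∂W n u ⊗ word v) ⊕ prefix u (∂W n v))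
∂W-++ n [] v = ≡⇒≋ (sym (prefix-[] (∂W n v)))
∂W-++ n (l ∷ u) v = begin
  (A ⊗ word (u ++ v)) ⊕ (l ◃ ∂W n (u ++ v))
    ≈⟨ ⊕-cong (⊗-congʳ A (word-++ u v)) (≋-trans (≡⇒≋ (◃-prefix l _)) (prefix-cong [ l ] (∂W-++ n u v))) ⟩
  (A ⊗ (word u ⊗ word v)) ⊕ prefix [ l ] ((Du ⊗ word v) ⊕ prefix u Dv)
    ≈⟨ ⊕-cong (≋-sym (⊗-assoc A (word u) (word v))) (≡⇒≋ (prefix-⊕ [ l ] (Du ⊗ word v) (prefix u Dv))) ⟩
  ((A ⊗ word u) ⊗ word v) ⊕ (prefix [ l ] (Du ⊗ word v) ⊕ prefix [ l ] (prefix u Dv))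
    ≈⟨ ⊕-congʳ ((A ⊗ word u) ⊗ word v) (⊕-cong l◃Du⊗v (≡⇒≋ (prefix-prefix [ l ] u Dv))) ⟩
  ((A ⊗ word u) ⊗ word v) ⊕ (((l ◃ Du) ⊗ word v) ⊕ prefix (l ∷ u) Dv)
    ≈⟨ ⊕-assoc ((A ⊗ word u) ⊗ word v) ((l ◃ Du) ⊗ word v) (prefix (l ∷ u) Dv) ⟨
  (((A ⊗ word u) ⊗ word v) ⊕ ((l ◃ Du) ⊗ word v)) ⊕ prefix (l ∷ u) Dv
    ≈⟨ ⊕-congˡ (prefix (l ∷ u) Dv) (⊗-⊕ˡ (A ⊗ word u) (l ◃ Du) (word v)) ⟨
  (((A ⊗ word u) ⊕ (l ◃ Du)) ⊗ word v) ⊕ prefix (l ∷ u) Dv ∎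
  where
  A Du Dv : Poly
  A = ∂L n l
  Du = ∂W n u
  Dv = ∂W n v
  l◃Du⊗v : prefix [ l ] (Du ⊗ word v) ≋ ((l ◃ Du) ⊗ word v)
  l◃Du⊗v = ≋-trans (≡⇒≋ (sym (◃-prefix l (Du ⊗ word v)))) (◃-⊗ l Du (word v))

∂-prefix : ∀ n v q → ∂ n (prefix v q) ≋ ((∂W n v ⊗ q) ⊕ prefix v (∂ n q))
∂-prefix n v q = begin
  ∂ n (prefix v q)
    ≈⟨ ∂-cong n (prefix-lin v q) ⟩
  ∂ n (lin (λ w → word (v ++ w)) q)
    ≈⟨ ∂-lin∘ n (λ w → word (v ++ w)) q ⟩
  lin (λ w → ∂ n (word (v ++ w))) q
    ≈⟨ lin-cong∘ q (λ w → ≋-trans (∂-word n (v ++ w)) (∂W-++ n v w)) ⟩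
  lin (λ w → (∂W n v ⊗ word w) ⊕ prefix v (∂W n w)) q
    ≈⟨ lin-⊕∘ (λ w → ∂W n v ⊗ word w) (λ w → prefix v (∂W n w)) q ⟩
  (lin (λ w → ∂W n v ⊗ word w) q ⊕ lin (λ w → prefix v (∂W n w)) q)
    ≈⟨ ⊕-cong (⊗-word-lin (∂W n v) q) (≋-trans (≋-sym (prefix-lin∘ v (∂W n) q)) (≡⇒≋ (cong (prefix v) (sym (∂-lin n q))))) ⟩
  ((∂W n v ⊗ q) ⊕ prefix v (∂ n q)) ∎

∂-⊗ : ∀ n p q → ∂ n (p ⊗ q) ≋ ((∂ n p ⊗ q) ⊕ (p ⊗ ∂ n q))
∂-⊗ n p q = begin
  ∂ n (p ⊗ q)
    ≈⟨ ∂-cong n (≡⇒≋ (⊗-lin p q)) ⟩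
  ∂ n (lin (λ v → prefix v q) p)
    ≈⟨ ∂-lin∘ n (λ v → prefix v q) p ⟩
  lin (λ v → ∂ n (prefix v q)) p
    ≈⟨ lin-cong∘ p (λ v → ∂-prefix n v q) ⟩
  lin (λ v → (∂W n v ⊗ q) ⊕ prefix v (∂ n q)) p
    ≈⟨ lin-⊕∘ (λ v → ∂W n v ⊗ q) (λ v → prefix v (∂ n q)) p ⟩
  (lin (λ v → ∂W n v ⊗ q) p ⊕ lin (λ v → prefix v (∂ n q)) p)
    ≈⟨ ⊕-cong (≋-trans (≋-sym (⊗-lin∘ˡ (∂W n) p q)) (⊗-congˡ q (≡⇒≋ (sym (∂-lin n p))))) (≡⇒≋ (sym (⊗-lin p (∂ n q)))) ⟩
  ((∂ n p ⊗ q) ⊕ (p ⊗ ∂ n q)) ∎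

∂-word-x : ∀ n → ∂ n (word [ x ]) ≋ dgen n
∂-word-x n = ≋-trans (∂-word n [ x ]) (≋-trans (⊕-identityʳ _) (⊗-word[] (dgen n)))

∂-word-y : ∀ n → ∂ n (word [ y ]) ≋ scale (- 1ℚ) (dgen n)
∂-word-y n = ≋-trans (∂-word n [ y ]) (≋-trans (⊕-identityʳ _) (⊗-word[] (scale (- 1ℚ) (dgen n))))

times : ℕ → Poly → Poly
times zero p = []
times (suc n) p = p ⊕ times n p

times-cong : ∀ n {p q} → p ≋ q → times n p ≋ times n q
times-cong zero e = ≋-refl
times-cong (suc n) e = ⊕-cong e (times-cong n e)

times-+ : ∀ m n p → times (m N.+ n) p ≋ (times m p ⊕ times n p)
times-+ zero n p = ≋-refl
times-+ (suc m) n p = ≋-trans (⊕-congʳ p (times-+ m n p)) (≋-sym (⊕-assoc p (times m p) (times n p)))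

times-⊕ : ∀ n p q → times n (p ⊕ q) ≋ (times n p ⊕ times n q)
times-⊕ zero p q = ≋-refl
times-⊕ (suc n) p q = ≋-trans (⊕-congʳ (p ⊕ q) (times-⊕ n p q)) (⊕-interchange p q (times n p) (times n q))

times-⊗ˡ : ∀ n p q → (times n p ⊗ q) ≋ times n (p ⊗ q)
times-⊗ˡ zero p q = ≋-refl
times-⊗ˡ (suc n) p q = ≋-trans (⊗-⊕ˡ p (times n p) q) (⊕-congʳ (p ⊗ q) (times-⊗ˡ n p q))

times-⊗ʳ : ∀ n p q → (p ⊗ times n q) ≋ times n (p ⊗ q)
times-⊗ʳ zero p q = ⊗-[]ʳ p
times-⊗ʳ (suc n) p q = ≋-trans (⊗-⊕ʳ p q (times n q)) (⊕-congʳ (p ⊗ q) (times-⊗ʳ n p q))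

times-scale : ∀ n c p → times n (scale c p) ≋ scale c (times n p)
times-scale zero c p = ≋-refl
times-scale (suc n) c p = ≋-trans (⊕-congʳ (scale c p) (times-scale n c p)) (≡⇒≋ (sym (scale-⊕ c p (times n p))))

times-lin : ∀ n f p → times n (lin f p) ≋ lin (λ w → times n (f w)) p
times-lin zero f p = ≋-sym (lin-zero p)
times-lin (suc n) f p = ≋-trans (⊕-congʳ (lin f p) (times-lin n f p)) (≋-sym (lin-⊕∘ f (λ w → times n (f w)) p))

toℚ : ℕ → ℚ
toℚ zero = 0ℚ
toℚ (suc n) = 1ℚ + toℚ n

toℚ-nonNeg : ∀ n → NonNegative (toℚ n)
toℚ-nonNeg zero = _
toℚ-nonNeg (suc n) = QP.nonNeg+nonNeg⇒nonNeg 1ℚ (toℚ n) {{toℚ-nonNeg n}}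

toℚ-suc-nonZero : ∀ n → NonZero (toℚ (suc n))
toℚ-suc-nonZero n = QP.pos⇒nonZero (toℚ (suc n)) {{QP.pos+nonNeg⇒pos 1ℚ (toℚ n) {{toℚ-nonNeg n}}}}

1/suc : ℕ → ℚ
1/suc n = (1/ toℚ (suc n)) {{toℚ-suc-nonZero n}}

coeff-times : ∀ n q w → coeff (times n q) w ≡ toℚ n * coeff q w
coeff-times zero q w = sym (QP.*-zeroˡ (coeff q w))
coeff-times (suc n) q w = trans (coeff-⊕ q (times n q) w) (trans (cong (coeff q w +_) (coeff-times n q w))
  (solve 2 (λ c t → c :+ t :* c := (con 1ℚ :+ t) :* c) refl (coeff q w) (toℚ n)))

scale-1/suc-times : ∀ n q → scale (1/suc n) (times (suc n) q) ≋ q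
scale-1/suc-times n q = mk λ w → trans (coeff-scale (1/suc n) (times (suc n) q) w)
  (trans (cong (1/suc n *_) (coeff-times (suc n) q w))
    (trans (sym (QP.*-assoc (1/suc n) (toℚ (suc n)) (coeff q w)))
      (trans (cong (_* coeff q w) (QP.*-inverseˡ (toℚ (suc n)) {{toℚ-suc-nonZero n}})) (QP.*-identityˡ (coeff q w)))))

∑ : ℕ → (ℕ → ℕ → Poly) → Poly
∑ zero h = h 0 0
∑ (suc j) h = h 0 (suc j) ⊕ ∑ j (λ i k → h (suc i) k)

infix 5 ∑
syntax ∑ j (λ i k → e) = ∑[ i + k ≐ j ] e

∑-cong-≐ : ∀ j {h h′} → (∀ i k → i N.+ k ≡ j → h i k ≋ h′ i k) → ∑ j h ≋ ∑ j h′
∑-cong-≐ zero e = e 0 0 refl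
∑-cong-≐ (suc j) e = ⊕-cong (e 0 (suc j) refl) (∑-cong-≐ j (λ i k i+k≡j → e (suc i) k (cong suc i+k≡j)))

∑-cong : ∀ j {h h′} → (∀ i k → h i k ≋ h′ i k) → ∑ j h ≋ ∑ j h′
∑-cong j e = ∑-cong-≐ j (λ i k _ → e i k)

∑-⊕ : ∀ j h h′ → (∑[ i + k ≐ j ] (h i k ⊕ h′ i k)) ≋ (∑ j h ⊕ ∑ j h′)
∑-⊕ zero h h′ = ≋-refl
∑-⊕ (suc j) h h′ = begin
  (h 0 (suc j) ⊕ h′ 0 (suc j)) ⊕ (∑[ i + k ≐ j ] h (suc i) k ⊕ h′ (suc i) k)
    ≈⟨ ⊕-congʳ _ (∑-⊕ j (λ i k → h (suc i) k) (λ i k → h′ (suc i) k)) ⟩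
  (h 0 (suc j) ⊕ h′ 0 (suc j)) ⊕ ((∑[ i + k ≐ j ] h (suc i) k) ⊕ (∑[ i + k ≐ j ] h′ (suc i) k))
    ≈⟨ ⊕-interchange (h 0 (suc j)) (h′ 0 (suc j)) (∑[ i + k ≐ j ] h (suc i) k) (∑[ i + k ≐ j ] h′ (suc i) k) ⟩
  ∑ (suc j) h ⊕ ∑ (suc j) h′ ∎

∑-additive : ∀ (L : Poly → Poly) → (∀ p q → L (p ⊕ q) ≋ (L p ⊕ L q)) →
             ∀ j h → L (∑ j h) ≋ (∑[ i + k ≐ j ] L (h i k))
∑-additive L L-⊕ zero h = ≋-refl
∑-additive L L-⊕ (suc j) h =
  ≋-trans (L-⊕ _ _) (⊕-congʳ (L (h 0 (suc j))) (∑-additive L L-⊕ j (λ i k → h (suc i) k)))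

∑-[] : ∀ j → (∑[ i + k ≐ j ] []) ≋ []
∑-[] zero = ≋-refl
∑-[] (suc j) = ∑-[] j

∑-last : ∀ j h → ∑ (suc j) h ≋ ((∑[ i + k ≐ j ] h i (suc k)) ⊕ h (suc j) 0)
∑-last zero h = ≋-refl
∑-last (suc j) h = ≋-trans (⊕-congʳ (h 0 (suc (suc j))) (∑-last j (λ i k → h (suc i) k)))
  (≋-sym (⊕-assoc (h 0 (suc (suc j))) (∑[ i + k ≐ j ] h (suc i) (suc k)) (h (suc (suc j)) 0)))

∑-comm : ∀ j h → ∑ j h ≋ (∑[ i + k ≐ j ] h k i)
∑-comm zero h = ≋-refl
∑-comm (suc j) h = begin
  h 0 (suc j) ⊕ (∑[ i + k ≐ j ] h (suc i) k)  ≈⟨ ⊕-congʳ (h 0 (suc j)) (∑-comm j (λ i k → h (suc i) k)) ⟩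
  h 0 (suc j) ⊕ (∑[ i + k ≐ j ] h (suc k) i)  ≈⟨ ⊕-comm (h 0 (suc j)) (∑[ i + k ≐ j ] h (suc k) i) ⟩
  (∑[ i + k ≐ j ] h (suc k) i) ⊕ h 0 (suc j)  ≈⟨ ∑-last j (λ i k → h k i) ⟨
  ∑[ i + k ≐ suc j ] h k i                    ∎

∑-assoc : ∀ j (h : ℕ → ℕ → ℕ → Poly) →
          (∑[ a + r ≐ j ] ∑[ b + c ≐ r ] h a b c) ≋ (∑[ s + c ≐ j ] ∑[ a + b ≐ s ] h a b c)
∑-assoc zero h = ≋-refl
∑-assoc (suc j) h = begin
  (h 0 0 (suc j) ⊕ (∑[ b + c ≐ j ] h 0 (suc b) c)) ⊕ (∑[ a + r ≐ j ] ∑[ b + c ≐ r ] h (suc a) b c)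
    ≈⟨ ⊕-assoc (h 0 0 (suc j)) (∑[ b + c ≐ j ] h 0 (suc b) c) (∑[ a + r ≐ j ] ∑[ b + c ≐ r ] h (suc a) b c) ⟩
  h 0 0 (suc j) ⊕ ((∑[ b + c ≐ j ] h 0 (suc b) c) ⊕ (∑[ a + r ≐ j ] ∑[ b + c ≐ r ] h (suc a) b c))
    ≈⟨ ⊕-congʳ (h 0 0 (suc j)) (⊕-congʳ _ (∑-assoc j (λ a b c → h (suc a) b c))) ⟩
  h 0 0 (suc j) ⊕ ((∑[ s + c ≐ j ] h 0 (suc s) c) ⊕ (∑[ s + c ≐ j ] ∑[ a + b ≐ s ] h (suc a) b c))
    ≈⟨ ⊕-congʳ (h 0 0 (suc j)) (∑-⊕ j _ _) ⟨
  ∑[ s + c ≐ suc j ] ∑[ a + b ≐ s ] h a b c ∎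

∑-swap : ∀ j (h : ℕ → ℕ → ℕ → Poly) →
         (∑[ a + r ≐ j ] ∑[ b + c ≐ r ] h a b c) ≋ (∑[ b + r ≐ j ] ∑[ a + c ≐ r ] h a b c)
∑-swap j h = begin
  ∑[ a + r ≐ j ] ∑[ b + c ≐ r ] h a b c  ≈⟨ ∑-assoc j h ⟩
  ∑[ s + c ≐ j ] ∑[ a + b ≐ s ] h a b c  ≈⟨ ∑-cong j (λ s c → ∑-comm s (λ a b → h a b c)) ⟩
  ∑[ s + c ≐ j ] ∑[ b + a ≐ s ] h a b c  ≈⟨ ∑-assoc j (λ b a c → h a b c) ⟨
  ∑[ b + r ≐ j ] ∑[ a + c ≐ r ] h a b c  ∎

∑-collapse : ∀ j h → (∀ i r → i N.+ suc r ≡ j → h i (suc r) ≋ []) → ∑ j h ≋ h j 0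
∑-collapse zero h vanish = ≋-refl
∑-collapse (suc j) h vanish = begin
  ∑ (suc j) h                                     ≈⟨ ∑-last j h ⟩
  (∑[ i + r ≐ j ] h i (suc r)) ⊕ h (suc j) 0      ≈⟨ ⊕-congˡ _ (∑-cong-≐ j vanish′) ⟩
  (∑[ i + r ≐ j ] []) ⊕ h (suc j) 0               ≈⟨ ⊕-congˡ _ (∑-[] j) ⟩
  h (suc j) 0                                     ∎
  where
  vanish′ : ∀ i r → i N.+ r ≡ j → h i (suc r) ≋ []
  vanish′ i r i+r≡j = vanish i r (trans (NP.+-suc i r) (cong suc i+r≡j))

∑-⊗ˡ : ∀ j h q → (∑ j h ⊗ q) ≋ (∑[ i + k ≐ j ] (h i k ⊗ q))
∑-⊗ˡ j h q = ∑-additive (_⊗ q) (λ a b → ⊗-⊕ˡ a b q) j h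

∑-⊗ʳ : ∀ j p h → (p ⊗ ∑ j h) ≋ (∑[ i + k ≐ j ] (p ⊗ h i k))
∑-⊗ʳ j p h = ∑-additive (p ⊗_) (⊗-⊕ʳ p) j h

∑-scale : ∀ j c h → scale c (∑ j h) ≋ (∑[ i + k ≐ j ] scale c (h i k))
∑-scale j c h = ∑-additive (scale c) (λ a b → ≡⇒≋ (scale-⊕ c a b)) j h

∑-⊖ : ∀ j h h′ → (∑[ i + k ≐ j ] (h i k ⊖ h′ i k)) ≋ (∑ j h ⊖ ∑ j h′)
∑-⊖ j h h′ = ≋-trans (∑-⊕ j h _) (⊕-congʳ (∑ j h) (≋-sym (∑-scale j (- 1ℚ) h′)))

∑-times : ∀ j n h → times n (∑ j h) ≋ (∑[ i + k ≐ j ] times n (h i k))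
∑-times j n h = ∑-additive (times n) (times-⊕ n) j h

∑-∂ : ∀ j n h → ∂ n (∑ j h) ≋ (∑[ i + k ≐ j ] ∂ n (h i k))
∑-∂ j n h = ∑-additive (∂ n) (∂-⊕ n) j h

∑-prefix : ∀ j v h → prefix v (∑ j h) ≋ (∑[ i + k ≐ j ] prefix v (h i k))
∑-prefix j v h = ∑-additive (prefix v) (λ a b → ≡⇒≋ (prefix-⊕ v a b)) j h

lin-∑ : ∀ j (h : Word → ℕ → ℕ → Poly) p → lin (λ w → ∑ j (h w)) p ≋ (∑[ i + k ≐ j ] lin (λ w → h w i k) p)
lin-∑ zero h p = ≋-refl
lin-∑ (suc j) h p = ≋-trans (lin-⊕∘ (λ w → h w 0 (suc j)) (λ w → ∑ j (λ i k → h w (suc i) k)) p)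
  (⊕-congʳ _ (lin-∑ j (λ w i k → h w (suc i) k) p))

-- Formal power series in t over 𝔥, as their sequences of coefficients.
Series : Set
Series = ℕ → Poly

infixl 7 _⋆_
_⋆_ : Series → Series → Series
(f ⋆ g) j = ∑[ i + k ≐ j ] (f i ⊗ g k)

-- The Euler operator t d/dt.
θ : Series → Series
θ F j = times j (F j)

-- The operator ∑ₙ tⁿ ∂ₙ, n ≥ 1.
∂ₜ : Series → Series
∂ₜ F zero = []
∂ₜ F (suc j) = ∑[ n + k ≐ j ] ∂ (suc n) (F k)

⋆-cong : ∀ {f f′ g g′} → (∀ i → f i ≋ f′ i) → (∀ k → g k ≋ g′ k) → ∀ j → (f ⋆ g) j ≋ (f′ ⋆ g′) j
⋆-cong f≋f′ g≋g′ j = ∑-cong j (λ i k → ⊗-cong (f≋f′ i) (g≋g′ k))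

θ-⋆ : ∀ f g j → θ (f ⋆ g) j ≋ ((θ f ⋆ g) j ⊕ (f ⋆ θ g) j)
θ-⋆ f g j = begin
  times j (∑[ i + k ≐ j ] (f i ⊗ g k))                              ≈⟨ ∑-times j j _ ⟩
  ∑[ i + k ≐ j ] times j (f i ⊗ g k)                                ≈⟨ ∑-cong-≐ j leibniz ⟩
  ∑[ i + k ≐ j ] ((times i (f i) ⊗ g k) ⊕ (f i ⊗ times k (g k)))   ≈⟨ ∑-⊕ j _ _ ⟩
  (θ f ⋆ g) j ⊕ (f ⋆ θ g) j                                         ∎
  where
  leibniz : ∀ i k → i N.+ k ≡ j → times j (f i ⊗ g k) ≋ ((times i (f i) ⊗ g k) ⊕ (f i ⊗ times k (g k)))
  leibniz i k refl = ≋-trans (times-+ i k (f i ⊗ g k))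
    (⊕-cong (≋-sym (times-⊗ˡ i (f i) (g k))) (≋-sym (times-⊗ʳ k (f i) (g k))))

∂ₜ-⋆ : ∀ f g j → ∂ₜ (f ⋆ g) j ≋ ((∂ₜ f ⋆ g) j ⊕ (f ⋆ ∂ₜ g) j)
∂ₜ-⋆ f g zero = ≋-sym (⊕-congʳ ([] ⊗ g 0) (⊗-[]ʳ (f 0)))
∂ₜ-⋆ f g (suc j) = begin
  ∑[ n + k ≐ j ] ∂ (suc n) (∑[ i + l ≐ k ] (f i ⊗ g l))
    ≈⟨ ∑-cong j (λ n k → ≋-trans (∑-∂ k (suc n) _) (∑-cong k (λ i l → ∂-⊗ (suc n) (f i) (g l)))) ⟩
  ∑[ n + k ≐ j ] ∑[ i + l ≐ k ] ((∂ (suc n) (f i) ⊗ g l) ⊕ (f i ⊗ ∂ (suc n) (g l)))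
    ≈⟨ ∑-cong j (λ n k → ∑-⊕ k _ _) ⟩
  ∑[ n + k ≐ j ] ((∑[ i + l ≐ k ] (∂ (suc n) (f i) ⊗ g l)) ⊕ (∑[ i + l ≐ k ] (f i ⊗ ∂ (suc n) (g l))))
    ≈⟨ ∑-⊕ j _ _ ⟩
  (∑[ n + k ≐ j ] ∑[ i + l ≐ k ] (∂ (suc n) (f i) ⊗ g l)) ⊕ (∑[ n + k ≐ j ] ∑[ i + l ≐ k ] (f i ⊗ ∂ (suc n) (g l)))
    ≈⟨ ⊕-cong ∂ₜf⋆g ∂f⋆∂ₜg ⟩
  (∂ₜ f ⋆ g) (suc j) ⊕ (f ⋆ ∂ₜ g) (suc j) ∎
  where
  ∂ₜf⋆g : (∑[ n + k ≐ j ] ∑[ i + l ≐ k ] (∂ (suc n) (f i) ⊗ g l)) ≋ (∂ₜ f ⋆ g) (suc j)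
  ∂ₜf⋆g = begin
    ∑[ n + k ≐ j ] ∑[ i + l ≐ k ] (∂ (suc n) (f i) ⊗ g l)  ≈⟨ ∑-assoc j _ ⟩
    ∑[ s + l ≐ j ] ∑[ n + i ≐ s ] (∂ (suc n) (f i) ⊗ g l)  ≈⟨ ∑-cong j (λ s l → ∑-⊗ˡ s _ (g l)) ⟨
    ∑[ s + l ≐ j ] (∂ₜ f (suc s) ⊗ g l)                    ≡⟨⟩
    ([] ⊗ g (suc j)) ⊕ (∑[ s + l ≐ j ] ∂ₜ f (suc s) ⊗ g l)  ∎
  ∂f⋆∂ₜg : (∑[ n + k ≐ j ] ∑[ i + l ≐ k ] (f i ⊗ ∂ (suc n) (g l))) ≋ (f ⋆ ∂ₜ g) (suc j)
  ∂f⋆∂ₜg = begin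
    ∑[ n + k ≐ j ] ∑[ i + l ≐ k ] (f i ⊗ ∂ (suc n) (g l))  ≈⟨ ∑-swap j _ ⟩
    ∑[ i + r ≐ j ] ∑[ n + l ≐ r ] (f i ⊗ ∂ (suc n) (g l))  ≈⟨ ∑-cong j (λ i r → ∑-⊗ʳ r (f i) _) ⟨
    ∑[ i + r ≐ j ] (f i ⊗ ∂ₜ g (suc r))                    ≈⟨ ⊕-identityʳ _ ⟨
    (∑[ i + r ≐ j ] (f i ⊗ ∂ₜ g (suc r))) ⊕ []             ≈⟨ ⊕-congʳ _ (⊗-[]ʳ (f (suc j))) ⟨
    (∑[ i + r ≐ j ] (f i ⊗ ∂ₜ g (suc r))) ⊕ (f (suc j) ⊗ ∂ₜ g 0)  ≈⟨ ∑-last j (λ i k → f i ⊗ ∂ₜ g k) ⟨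
    (f ⋆ ∂ₜ g) (suc j)                                      ∎

+-suc-≡⇒< : ∀ i r b → i N.+ suc r ≡ b → r N.< b
+-suc-≡⇒< i r b i+1+r≡b = subst (suc r N.≤_) i+1+r≡b (NP.m≤n+m (suc r) i)

⋆-collapse : ∀ f G b → (∀ r → r N.< b → G (suc r) ≋ []) → (f ⋆ G) b ≋ (f b ⊗ G 0)
⋆-collapse f G b G-vanish = ∑-collapse b _ (λ i r i+1+r≡b →
  ≋-trans (⊗-congʳ (f i) (G-vanish r (+-suc-≡⇒< i r b i+1+r≡b))) (⊗-[]ʳ (f i)))

pow-snoc : ∀ l n → (pow l n ++ [ l ]) ≡ pow l (suc n)
pow-snoc l zero = refl
pow-snoc l (suc n) = cong (l ∷_) (pow-snoc l n)

-- Split every word of z^{N+1} at its first x.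
zpow-suc : ∀ N → zpow (suc N) ≋ (word (pow y (suc N)) ⊕ (∑[ s + n ≐ N ] prefix (pow y s) (x ◃ zpow n)))
zpow-suc zero = ≋-trans (⊕-comm (x ◃ word []) (y ◃ word []))
  (⊕-congʳ (word [ y ]) (≡⇒≋ (sym (prefix-[] (x ◃ word [])))))
zpow-suc (suc N) = begin
  (x ◃ zpow (suc N)) ⊕ (y ◃ zpow (suc N))
    ≈⟨ ⊕-congʳ _ (≋-trans (≡⇒≋ (◃-prefix y (zpow (suc N)))) (prefix-cong [ y ] (zpow-suc N))) ⟩
  (x ◃ zpow (suc N)) ⊕ prefix [ y ] (word (pow y (suc N)) ⊕ XZ)
    ≈⟨ ⊕-congʳ _ (≋-trans (≡⇒≋ (prefix-⊕ [ y ] (word (pow y (suc N))) XZ)) (⊕-congʳ _ yXZ)) ⟩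
  (x ◃ zpow (suc N)) ⊕ (word (pow y (suc (suc N))) ⊕ yXZ′)
    ≈⟨ ⊕-swap (x ◃ zpow (suc N)) (word (pow y (suc (suc N)))) yXZ′ ⟩
  word (pow y (suc (suc N))) ⊕ ((x ◃ zpow (suc N)) ⊕ yXZ′)
    ≈⟨ ⊕-congʳ (word (pow y (suc (suc N)))) (⊕-congˡ yXZ′ (≡⇒≋ (sym (prefix-[] (x ◃ zpow (suc N)))))) ⟩
  word (pow y (suc (suc N))) ⊕ (∑[ s + n ≐ suc N ] prefix (pow y s) (x ◃ zpow n)) ∎
  where
  XZ yXZ′ : Poly
  XZ = ∑[ s + n ≐ N ] prefix (pow y s) (x ◃ zpow n)
  yXZ′ = ∑[ s + n ≐ N ] prefix (pow y (suc s)) (x ◃ zpow n)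
  yXZ : prefix [ y ] XZ ≋ yXZ′
  yXZ = ≋-trans (∑-prefix N [ y ] _) (∑-cong N (λ s n → ≡⇒≋ (prefix-prefix [ y ] (pow y s) (x ◃ zpow n))))

x⊗prefix-x◃⊗ : ∀ u q r → (word [ x ] ⊗ (prefix u (x ◃ q) ⊗ r)) ≋ (word (x ∷ u) ⊗ (word [ x ] ⊗ (q ⊗ r)))
x⊗prefix-x◃⊗ u q r = begin
  word [ x ] ⊗ (prefix u (x ◃ q) ⊗ r)
    ≈⟨ word-⊗ [ x ] (prefix u (x ◃ q) ⊗ r) ⟩
  prefix [ x ] (prefix u (x ◃ q) ⊗ r)
    ≈⟨ prefix-cong [ x ] (≋-trans (prefix-⊗ u (x ◃ q) r) (prefix-cong u x◃q⊗r)) ⟩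
  prefix [ x ] (prefix u (prefix [ x ] (q ⊗ r)))
    ≈⟨ ≡⇒≋ (prefix-prefix [ x ] u (prefix [ x ] (q ⊗ r))) ⟩
  prefix (x ∷ u) (prefix [ x ] (q ⊗ r))
    ≈⟨ ≋-trans (word-⊗ (x ∷ u) (word [ x ] ⊗ (q ⊗ r))) (prefix-cong (x ∷ u) (word-⊗ [ x ] (q ⊗ r))) ⟨
  word (x ∷ u) ⊗ (word [ x ] ⊗ (q ⊗ r)) ∎
  where
  x◃q⊗r : ((x ◃ q) ⊗ r) ≋ prefix [ x ] (q ⊗ r)
  x◃q⊗r = ≋-trans (⊗-congˡ r (≡⇒≋ (◃-prefix x q))) (prefix-⊗ [ x ] q r)

word-x∷yᵏ-snoc : ∀ k → word (x ∷ pow y (suc k)) ≋ (word (x ∷ pow y k) ⊗ word [ y ])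
word-x∷yᵏ-snoc k = ≋-trans (≡⇒≋ (cong (λ t → word (x ∷ t)) (sym (pow-snoc y k)))) (word-++ (x ∷ pow y k) [ y ])

dgen-suc-suc : ∀ j → dgen (suc (suc j)) ≋
               (word (x ∷ pow y (suc (suc j))) ⊕ (∑[ n + k ≐ j ] (word (x ∷ pow y k) ⊗ dgen (suc n))))
dgen-suc-suc j = begin
  word [ x ] ⊗ (zpow (suc j) ⊗ word [ y ])
    ≈⟨ ⊗-congʳ (word [ x ]) (⊗-congˡ (word [ y ]) (zpow-suc j)) ⟩
  word [ x ] ⊗ ((word (pow y (suc j)) ⊕ XZ) ⊗ word [ y ])
    ≈⟨ ≋-trans (⊗-congʳ (word [ x ]) (⊗-⊕ˡ yʲ⁺¹ XZ (word [ y ]))) (⊗-⊕ʳ (word [ x ]) (yʲ⁺¹ ⊗ word [ y ]) (XZ ⊗ word [ y ])) ⟩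
  (word [ x ] ⊗ (word (pow y (suc j)) ⊗ word [ y ])) ⊕ (word [ x ] ⊗ (XZ ⊗ word [ y ]))
    ≈⟨ ⊕-cong xyʲ⁺¹y xXZy ⟩
  word (x ∷ pow y (suc (suc j))) ⊕ (∑[ n + k ≐ j ] (word (x ∷ pow y k) ⊗ dgen (suc n))) ∎
  where
  yʲ⁺¹ : Poly
  yʲ⁺¹ = word (pow y (suc j))
  XZ : Poly
  XZ = ∑[ s + n ≐ j ] prefix (pow y s) (x ◃ zpow n)
  xyʲ⁺¹y : (word [ x ] ⊗ (word (pow y (suc j)) ⊗ word [ y ])) ≋ word (x ∷ pow y (suc (suc j)))
  xyʲ⁺¹y = ≋-trans (≋-sym (⊗-assoc (word [ x ]) (word (pow y (suc j))) (word [ y ]))) (≋-sym (word-x∷yᵏ-snoc (suc j)))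
  xXZy : (word [ x ] ⊗ (XZ ⊗ word [ y ])) ≋ (∑[ n + k ≐ j ] (word (x ∷ pow y k) ⊗ dgen (suc n)))
  xXZy = begin
    word [ x ] ⊗ (XZ ⊗ word [ y ])
      ≈⟨ ⊗-congʳ (word [ x ]) (∑-⊗ˡ j _ _) ⟩
    word [ x ] ⊗ (∑[ s + n ≐ j ] (prefix (pow y s) (x ◃ zpow n) ⊗ word [ y ]))
      ≈⟨ ∑-⊗ʳ j (word [ x ]) _ ⟩
    ∑[ s + n ≐ j ] (word [ x ] ⊗ (prefix (pow y s) (x ◃ zpow n) ⊗ word [ y ]))
      ≈⟨ ∑-cong j (λ s n → x⊗prefix-x◃⊗ (pow y s) (zpow n) (word [ y ])) ⟩
    ∑[ s + n ≐ j ] (word (x ∷ pow y s) ⊗ dgen (suc n))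
      ≈⟨ ∑-comm j _ ⟩
    ∑[ n + k ≐ j ] (word (x ∷ pow y k) ⊗ dgen (suc n)) ∎

∂-word-x∷yᵏ-snoc : ∀ n k → ∂ (suc n) (word (x ∷ pow y (suc k))) ≋
                   ((∂ (suc n) (word (x ∷ pow y k)) ⊗ word [ y ]) ⊖ (word (x ∷ pow y k) ⊗ dgen (suc n)))
∂-word-x∷yᵏ-snoc n k = begin
  ∂ (suc n) (word (x ∷ pow y (suc k)))         ≈⟨ ∂-cong (suc n) (word-x∷yᵏ-snoc k) ⟩
  ∂ (suc n) (xyᵏ ⊗ word [ y ])                 ≈⟨ ∂-⊗ (suc n) xyᵏ (word [ y ]) ⟩
  (∂ (suc n) xyᵏ ⊗ word [ y ]) ⊕ (xyᵏ ⊗ ∂ (suc n) (word [ y ]))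
    ≈⟨ ⊕-congʳ (∂ (suc n) xyᵏ ⊗ word [ y ]) (≋-trans (⊗-congʳ xyᵏ (∂-word-y (suc n))) (⊗-scaleʳ (- 1ℚ) xyᵏ (dgen (suc n)))) ⟩
  (∂ (suc n) xyᵏ ⊗ word [ y ]) ⊖ (xyᵏ ⊗ dgen (suc n)) ∎
  where
  xyᵏ : Poly
  xyᵏ = word (x ∷ pow y k)

-- The coefficients of Φₜ(x) = x (1 - t y)⁻¹ and Φₜ(y) = z - Φₜ(x) = y - x t y (1 - t y)⁻¹.
φ : Letter → Series
φ x i = word (x ∷ pow y i)
φ y zero = word [ y ]
φ y (suc i) = scale (- 1ℚ) (word (x ∷ pow y (suc i)))

-- ∑_{n+k=j} ∂ₙ₊₁(x yᵏ) = (j + 1) x yʲ⁺¹: by Leibniz ∂ₙ₊₁(x yᵏ⁺¹) = ∂ₙ₊₁(x yᵏ) y - x yᵏ x zⁿ y,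
-- and the subtracted terms are exactly what ∂ⱼ₊₂(x) = x zʲ⁺¹ y contributes besides x yʲ⁺².
θφx≋∂ₜφx : ∀ j → θ (φ x) (suc j) ≋ ∂ₜ (φ x) (suc j)
θφx≋∂ₜφx zero = ≋-sym (∂-word-x 1)
θφx≋∂ₜφx (suc j) = ≋-sym (begin
  ∑[ n + k ≐ suc j ] ∂ (suc n) (φ x k)
    ≈⟨ ∑-last j (λ n k → ∂ (suc n) (φ x k)) ⟩
  (∑[ n + k ≐ j ] ∂ (suc n) (φ x (suc k))) ⊕ ∂ (suc (suc j)) (word [ x ])
    ≈⟨ ⊕-cong (∑-cong j ∂-word-x∷yᵏ-snoc) (∂-word-x (suc (suc j))) ⟩
  (∑[ n + k ≐ j ] ((∂ (suc n) (φ x k) ⊗ word [ y ]) ⊖ (φ x k ⊗ dgen (suc n)))) ⊕ dgen (suc (suc j))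
    ≈⟨ ⊕-cong (≋-trans (∑-⊖ j _ _) (⊕-congˡ (scale (- 1ℚ) M) (≋-sym (∑-⊗ˡ j _ (word [ y ]))))) (dgen-suc-suc j) ⟩
  ((∂ₜ (φ x) (suc j) ⊗ word [ y ]) ⊖ M) ⊕ (Y ⊕ M)
    ≈⟨ ⊕-congˡ (Y ⊕ M) (⊕-congˡ (scale (- 1ℚ) M) (≋-trans (⊗-congˡ (word [ y ]) (≋-sym (θφx≋∂ₜφx j))) jY)) ⟩
  (times (suc j) Y ⊖ M) ⊕ (Y ⊕ M)
    ≈⟨ ⊖-⊕-cancel (times (suc j) Y) M Y ⟩
  times (suc (suc j)) Y ∎)
  where
  Y : Poly
  Y = word (x ∷ pow y (suc (suc j)))
  M : Poly
  M = ∑[ n + k ≐ j ] (word (x ∷ pow y k) ⊗ dgen (suc n))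
  jY : (times (suc j) (φ x (suc j)) ⊗ word [ y ]) ≋ times (suc j) Y
  jY = ≋-trans (times-⊗ˡ (suc j) (φ x (suc j)) (word [ y ])) (times-cong (suc j) (≋-sym (word-x∷yᵏ-snoc (suc j))))

∂-φy : ∀ m k → ∂ m (φ y k) ≋ scale (- 1ℚ) (∂ m (φ x k))
∂-φy m zero = ≋-trans (∂-word-y m) (scale-cong (- 1ℚ) (≋-sym (∂-word-x m)))
∂-φy m (suc k) = ∂-scale m (- 1ℚ) (word (x ∷ pow y (suc k)))

θφ≋∂ₜφ : ∀ l j → θ (φ l) j ≋ ∂ₜ (φ l) j
θφ≋∂ₜφ l zero = ≋-refl
θφ≋∂ₜφ x (suc j) = θφx≋∂ₜφx j
θφ≋∂ₜφ y (suc j) = begin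
  times (suc j) (scale (- 1ℚ) (φ x (suc j)))          ≈⟨ times-scale (suc j) (- 1ℚ) _ ⟩
  scale (- 1ℚ) (θ (φ x) (suc j))                       ≈⟨ scale-cong (- 1ℚ) (θφx≋∂ₜφx j) ⟩
  scale (- 1ℚ) (∑[ n + k ≐ j ] ∂ (suc n) (φ x k))      ≈⟨ ∑-scale j (- 1ℚ) _ ⟩
  ∑[ n + k ≐ j ] scale (- 1ℚ) (∂ (suc n) (φ x k))      ≈⟨ ∑-cong j (λ n k → ∂-φy (suc n) k) ⟨
  ∑[ n + k ≐ j ] ∂ (suc n) (φ y k)                     ∎

𝟙 : Series
𝟙 zero = word []
𝟙 (suc j) = []

Φʷ : Word → Series
Φʷ [] = 𝟙
Φʷ (l ∷ w) = φ l ⋆ Φʷ w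

θ𝟙≋∂ₜ𝟙 : ∀ j → θ 𝟙 j ≋ ∂ₜ 𝟙 j
θ𝟙≋∂ₜ𝟙 zero = ≋-refl
θ𝟙≋∂ₜ𝟙 (suc j) = ≋-trans (times-[] (suc j)) (≋-sym (≋-trans (∑-cong j ∂𝟙) (∑-[] j)))
  where
  times-[] : ∀ n → times n [] ≋ []
  times-[] zero = ≋-refl
  times-[] (suc n) = times-[] n
  ∂𝟙 : ∀ n k → ∂ (suc n) (𝟙 k) ≋ []
  ∂𝟙 n zero = ≋-refl
  ∂𝟙 n (suc k) = ≋-refl

-- Both θ and ∂ₜ are derivations of ⋆ and they agree on the generators.
θΦʷ≋∂ₜΦʷ : ∀ w j → θ (Φʷ w) j ≋ ∂ₜ (Φʷ w) j
θΦʷ≋∂ₜΦʷ [] j = θ𝟙≋∂ₜ𝟙 j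
θΦʷ≋∂ₜΦʷ (l ∷ w) j = begin
  θ (φ l ⋆ Φʷ w) j                        ≈⟨ θ-⋆ (φ l) (Φʷ w) j ⟩
  (θ (φ l) ⋆ Φʷ w) j ⊕ (φ l ⋆ θ (Φʷ w)) j
    ≈⟨ ⊕-cong (⋆-cong (θφ≋∂ₜφ l) (λ k → ≋-refl {Φʷ w k}) j) (⋆-cong (λ i → ≋-refl {φ l i}) (θΦʷ≋∂ₜΦʷ w) j) ⟩
  (∂ₜ (φ l) ⋆ Φʷ w) j ⊕ (φ l ⋆ ∂ₜ (Φʷ w)) j ≈⟨ ∂ₜ-⋆ (φ l) (Φʷ w) j ⟨
  ∂ₜ (φ l ⋆ Φʷ w) j                       ∎

Φ : Poly → Series
Φ p j = lin (λ w → Φʷ w j) p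

lin-∂ₜ : ∀ p j → lin (λ w → ∂ₜ (Φʷ w) j) p ≋ ∂ₜ (Φ p) j
lin-∂ₜ p zero = lin-zero p
lin-∂ₜ p (suc j) = ≋-trans (lin-∑ j (λ w n k → ∂ (suc n) (Φʷ w k)) p)
  (∑-cong j (λ n k → ≋-sym (∂-lin∘ (suc n) (λ w → Φʷ w k) p)))

θΦ≋∂ₜΦ : ∀ p j → θ (Φ p) j ≋ ∂ₜ (Φ p) j
θΦ≋∂ₜΦ p j = begin
  times j (lin (λ w → Φʷ w j) p)       ≈⟨ times-lin j _ p ⟩
  lin (λ w → θ (Φʷ w) j) p             ≈⟨ lin-cong∘ p (λ w → θΦʷ≋∂ₜΦʷ w j) ⟩
  lin (λ w → ∂ₜ (Φʷ w) j) p            ≈⟨ lin-∂ₜ p j ⟩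
  ∂ₜ (Φ p) j                           ∎

Φʷ-0 : ∀ w → Φʷ w 0 ≋ word w
Φʷ-0 [] = ≋-refl
Φʷ-0 (l ∷ w) = ≋-trans (⊗-congʳ (φ l 0) (Φʷ-0 w)) (φ-0⊗ l)
  where
  φ-0⊗ : ∀ l → (φ l 0 ⊗ word w) ≋ word (l ∷ w)
  φ-0⊗ x = word-⊗ [ x ] (word w)
  φ-0⊗ y = word-⊗ [ y ] (word w)

Φ-cong : ∀ j {p q} → p ≋ q → Φ p j ≋ Φ q j
Φ-cong j = lin-cong (λ w → Φʷ w j)

Φ-⊕ : ∀ j p q → Φ (p ⊕ q) j ≋ (Φ p j ⊕ Φ q j)
Φ-⊕ j p q = ≡⇒≋ (lin-++ (λ w → Φʷ w j) p q)

Φ-0 : ∀ p → Φ p 0 ≋ p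
Φ-0 p = ≋-trans (lin-cong∘ p Φʷ-0) (lin-id p)

Φ-◃ : ∀ l q j → Φ (l ◃ q) j ≋ (φ l ⋆ Φ q) j
Φ-◃ l q j = begin
  Φ (l ◃ q) j                                      ≈⟨ Φ-cong j (≋-trans (≡⇒≋ (◃-prefix l q)) (prefix-lin [ l ] q)) ⟩
  lin (λ w → Φʷ w j) (lin (λ w → word (l ∷ w)) q)  ≈⟨ lin-lin _ _ q ⟩
  lin (λ w → lin (λ v → Φʷ v j) (word (l ∷ w))) q  ≈⟨ lin-cong∘ q (λ w → lin-word (λ v → Φʷ v j) (l ∷ w)) ⟩
  lin (λ w → ∑[ i + k ≐ j ] (φ l i ⊗ Φʷ w k)) q     ≈⟨ lin-∑ j _ q ⟩
  ∑[ i + k ≐ j ] lin (λ w → φ l i ⊗ Φʷ w k) q       ≈⟨ ∑-cong j (λ i k → ⊗-lin∘ʳ (φ l i) _ q) ⟨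
  ∑[ i + k ≐ j ] (φ l i ⊗ Φ q k)                    ∎

images-resp : ∀ {p q} → p ≋ q → InSumImages q → InSumImages p
images-resp p≋q (L , L-ok , q≈ΣL) = L , L-ok , (λ w → trans (get p≋q w) (q≈ΣL w))

images-[] : InSumImages []
images-[] = [] , [] , (λ w → refl)

sumPoly-map-++ : ∀ (f : ℕ × Poly → Poly) L M → sumPoly (map f (L ++ M)) ≋ (sumPoly (map f L) ⊕ sumPoly (map f M))
sumPoly-map-++ f [] M = ≋-refl
sumPoly-map-++ f (e ∷ L) M = ≋-trans (⊕-congʳ (f e) (sumPoly-map-++ f L M)) (≋-sym (⊕-assoc (f e) _ _))

≈sum-⊕ : ∀ (f : ℕ × Poly → Poly) {p q} L M → p ≈ sumPoly (map f L) → q ≈ sumPoly (map f M) →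
         (p ⊕ q) ≈ sumPoly (map f (L ++ M))
≈sum-⊕ f {p} {q} L M p≈ q≈ =
  get
    (≋-trans (⊕-cong {p} {sumPoly (map f L)} {q} {sumPoly (map f M)} (mk p≈) (mk q≈)) (≋-sym (sumPoly-map-++ f L M)))

images-⊕ : ∀ {p q} → InSumImages p → InSumImages q → InSumImages (p ⊕ q)
images-⊕ {p} {q} (L , L-ok , p≈ΣL) (M , M-ok , q≈ΣM) = (L ++ M) , All.++⁺ L-ok M-ok , ≈sum-⊕ _ {p} {q} L M p≈ΣL q≈ΣM

images-∑ : ∀ j h → (∀ i k → InSumImages (h i k)) → InSumImages (∑ j h)
images-∑ zero h h-ok = h-ok 0 0
images-∑ (suc j) h h-ok = images-⊕ {h 0 (suc j)} (h-ok 0 (suc j))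
  (images-∑ j (λ i k → h (suc i) k) (λ i k → h-ok (suc i) k))

∂-images : ∀ n u → InXhY u → InSumImages (∂ (suc n) u)
∂-images n u u∈xhy = [ (suc n , u) ] , (s≤s z≤n , u∈xhy) ∷ [] , get (≋-sym (⊕-identityʳ (∂ (suc n) u)))

AllWords : (Word → Set) → Poly → Set
AllWords P = All (λ term → P (proj₂ term))

AllWords-scale : ∀ {P} c p → AllWords P p → AllWords P (scale c p)
AllWords-scale c p = All.map⁺

AllWords-lin : ∀ {P Q} f p → (∀ w → Q w → AllWords P (f w)) → AllWords Q p → AllWords P (lin f p)
AllWords-lin f [] f-ok [] = []
AllWords-lin f ((c , w) ∷ p) f-ok (Qw ∷ p-ok) = All.++⁺ (AllWords-scale c (f w) (f-ok w Qw))
  (AllWords-lin f p f-ok p-ok)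

AllWords-⊗ : ∀ {P Q R : Word → Set} p q → AllWords P p → AllWords Q q →
             (∀ u v → P u → Q v → R (u ++ v)) → AllWords R (p ⊗ q)
AllWords-⊗ [] q _ _ _ = []
AllWords-⊗ {P} {Q} {R} ((c , u) ∷ p) q (Pu ∷ p-ok) q-ok PQ⇒R = All.++⁺ (prefixed q q-ok)
  (AllWords-⊗ p q p-ok q-ok PQ⇒R)
  where
  prefixed : ∀ q → AllWords Q q → AllWords R (map (λ { (d , v) → (c * d , u ++ v) }) q)
  prefixed [] [] = []
  prefixed ((d , v) ∷ q) (Qv ∷ q-ok) = PQ⇒R u v Pu Qv ∷ prefixed q q-ok

AllWords-∑ : ∀ {P} j h → (∀ i k → AllWords P (h i k)) → AllWords P (∑ j h)
AllWords-∑ zero h h-ok = h-ok 0 0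
AllWords-∑ (suc j) h h-ok = All.++⁺ (h-ok 0 (suc j)) (AllWords-∑ j (λ i k → h (suc i) k) (λ i k → h-ok (suc i) k))

AllWords⇒InXhY : ∀ p → AllWords XWordY p → InXhY p
AllWords⇒InXhY [] [] w _ = refl
AllWords⇒InXhY ((c , v) ∷ p) (v∈xhy ∷ p-ok) w w∉xhy with v ≟W w
... | yes refl = ⊥-elim (w∉xhy v∈xhy)
... | no _ = AllWords⇒InXhY p p-ok w w∉xhy

EndsWithY : Word → Set
EndsWithY w = ∃ λ u → w ≡ u ++ [ y ]

StartsWithX : Word → Set
StartsWithX w = ∃ λ u → w ≡ x ∷ u

φy-EndsWithY : ∀ i → AllWords EndsWithY (φ y i)
φy-EndsWithY zero = ([] , refl) ∷ []
φy-EndsWithY (suc i) = ((x ∷ pow y i) , cong (x ∷_) (sym (pow-snoc y i))) ∷ []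

𝟙-empty : ∀ k → AllWords (_≡ []) (𝟙 k)
𝟙-empty zero = refl ∷ []
𝟙-empty (suc k) = []

EndsWithY-⊗ : ∀ p q → AllWords EndsWithY q → AllWords EndsWithY (p ⊗ q)
EndsWithY-⊗ p q q-ok = AllWords-⊗ {λ _ → ⊤} p q (All.universal (λ _ → tt) p) q-ok append
  where
  append : ∀ u v → ⊤ → EndsWithY v → EndsWithY (u ++ v)
  append u _ _ (v , refl) = (u ++ v) , sym (LP.++-assoc u v [ y ])

XWordY-⊗ : ∀ p q → AllWords StartsWithX p → AllWords EndsWithY q → AllWords XWordY (p ⊗ q)
XWordY-⊗ p q p-ok q-ok = AllWords-⊗ p q p-ok q-ok append
  where
  append : ∀ u v → StartsWithX u → EndsWithY v → XWordY (u ++ v)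
  append _ _ (u , refl) (v , refl) = (u ++ v) , cong (x ∷_) (sym (LP.++-assoc u v [ y ]))

Φʷ-EndsWithY : ∀ v k → AllWords EndsWithY (Φʷ (v ++ [ y ]) k)
Φʷ-EndsWithY [] k = AllWords-∑ k _ (λ i j → AllWords-⊗ (φ y i) (𝟙 j) (φy-EndsWithY i) (𝟙-empty j) append)
  where
  append : ∀ u v → EndsWithY u → v ≡ [] → EndsWithY (u ++ v)
  append _ _ (u , refl) refl = u , LP.++-identityʳ (u ++ [ y ])
Φʷ-EndsWithY (l ∷ v) k = AllWords-∑ k _ (λ i j → EndsWithY-⊗ (φ l i) (Φʷ (v ++ [ y ]) j) (Φʷ-EndsWithY v j))

Φʷ-XWordY : ∀ v k → AllWords XWordY (Φʷ (x ∷ (v ++ [ y ])) k)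
Φʷ-XWordY v k = AllWords-∑ k _
  (λ i j → XWordY-⊗ (φ x i) (Φʷ (v ++ [ y ]) j) ((pow y i , refl) ∷ []) (Φʷ-EndsWithY v j))

Φ-XWordY : ∀ p k → AllWords XWordY p → AllWords XWordY (Φ p k)
Φ-XWordY p k = AllWords-lin (λ w → Φʷ w k) p (λ { w (v , refl) → Φʷ-XWordY v k })

-- Divide θ Φ = ∂ₜ Φ by j + 1; every Φₖ(p) stays in x𝔥y.
Φ-suc-images : ∀ p j → AllWords XWordY p → InSumImages (Φ p (suc j))
Φ-suc-images p j p-ok = images-resp Φₚ≋
  (images-∑ j (λ n k → ∂ (suc n) (scale r (Φ p k))) (λ n k → ∂-images n (scale r (Φ p k)) (scaled-xhy k)))
  where
  r : ℚ
  r = 1/suc j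
  scaled-xhy : ∀ k → InXhY (scale r (Φ p k))
  scaled-xhy k = AllWords⇒InXhY _ (AllWords-scale r (Φ p k) (Φ-XWordY p k p-ok))
  Φₚ≋ : Φ p (suc j) ≋ (∑[ n + k ≐ j ] ∂ (suc n) (scale r (Φ p k)))
  Φₚ≋ = begin
    Φ p (suc j)                                  ≈⟨ scale-1/suc-times j (Φ p (suc j)) ⟨
    scale r (θ (Φ p) (suc j))                    ≈⟨ scale-cong r (θΦ≋∂ₜΦ p (suc j)) ⟩
    scale r (∑[ n + k ≐ j ] ∂ (suc n) (Φ p k))   ≈⟨ ∑-scale j r _ ⟩
    ∑[ n + k ≐ j ] scale r (∂ (suc n) (Φ p k))   ≈⟨ ∑-cong j (λ n k → ∂-scale (suc n) r (Φ p k)) ⟨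
    ∑[ n + k ≐ j ] ∂ (suc n) (scale r (Φ p k))   ∎

-- Φₜ applied to a series in t: Φₜ(∑ F(c) tᶜ) = ∑ Φⱼ(F(c)) tʲ⁺ᶜ.
Φₜ : Series → Series
Φₜ F b = ∑[ j + c ≐ b ] Φ (F c) j

Φₜ-cong : ∀ {F G} → (∀ c → F c ≋ G c) → ∀ b → Φₜ F b ≋ Φₜ G b
Φₜ-cong F≋G b = ∑-cong b (λ j c → Φ-cong j (F≋G c))

Φₜ-0 : ∀ F → Φₜ F 0 ≋ F 0
Φₜ-0 F = Φ-0 (F 0)

Φₜ-◃ : ∀ l F b → Φₜ (λ c → l ◃ F c) b ≋ (φ l ⋆ Φₜ F) b
Φₜ-◃ l F b = begin
  ∑[ j + c ≐ b ] Φ (l ◃ F c) j                        ≈⟨ ∑-cong b (λ j c → Φ-◃ l (F c) j) ⟩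
  ∑[ j + c ≐ b ] ∑[ i + k ≐ j ] (φ l i ⊗ Φ (F c) k)   ≈⟨ ∑-assoc b _ ⟨
  ∑[ i + r ≐ b ] ∑[ k + c ≐ r ] (φ l i ⊗ Φ (F c) k)   ≈⟨ ∑-cong b (λ i r → ∑-⊗ʳ r (φ l i) _) ⟨
  ∑[ i + r ≐ b ] (φ l i ⊗ Φₜ F r)                     ∎

Φₜ𝟙-suc : ∀ r → Φₜ 𝟙 (suc r) ≋ []
Φₜ𝟙-suc r = ≋-trans (∑-last r (λ j c → Φ (𝟙 c) j)) (⊕-cong (∑-[] r) (lin-word (λ w → Φʷ w (suc r)) []))

word-x∷yᵏ-⊗-y◃ : ∀ k q → (word (x ∷ pow y k) ⊗ (y ◃ q)) ≋ (word (x ∷ pow y (suc k)) ⊗ q)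
word-x∷yᵏ-⊗-y◃ k q = begin
  word (x ∷ pow y k) ⊗ (y ◃ q)               ≈⟨ ⊗-congʳ (word (x ∷ pow y k)) y◃q≋y⊗q ⟩
  word (x ∷ pow y k) ⊗ (word [ y ] ⊗ q)      ≈⟨ ⊗-assoc (word (x ∷ pow y k)) (word [ y ]) q ⟨
  (word (x ∷ pow y k) ⊗ word [ y ]) ⊗ q      ≈⟨ ⊗-congˡ q (word-x∷yᵏ-snoc k) ⟨
  word (x ∷ pow y (suc k)) ⊗ q               ∎
  where
  y◃q≋y⊗q : (y ◃ q) ≋ (word [ y ] ⊗ q)
  y◃q≋y⊗q = ≋-trans (≡⇒≋ (◃-prefix y q)) (≋-sym (word-⊗ [ y ] q))

-- If F = t x F + y E and Φₜ E is constant, then so is Φₜ F: the coefficient b + 1 of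
-- Φₜ(x) Φₜ(F) t + Φₜ(y) Φₜ(E) is x yᵇ (y E₀) - x yᵇ⁺¹ E₀ = 0 by induction on b.
Φₜ-constant : ∀ F E → F 0 ≋ (y ◃ E 0) → (∀ c → F (suc c) ≋ ((x ◃ F c) ⊕ (y ◃ E (suc c)))) →
              (∀ r → Φₜ E (suc r) ≋ []) → ∀ b → Φₜ F (suc b) ≋ []
Φₜ-constant F E F₀ F-suc E-constant = <-rec (λ b → Φₜ F (suc b) ≋ []) step
  where
  step : ∀ b → (∀ {r} → r N.< b → Φₜ F (suc r) ≋ []) → Φₜ F (suc b) ≋ []
  step b ih = begin
    Φₜ F (suc b)
      ≈⟨ ∑-last b (λ j c → Φ (F c) j) ⟩
    (∑[ j + c ≐ b ] Φ (F (suc c)) j) ⊕ Φ (F 0) (suc b)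
      ≈⟨ ⊕-cong (∑-cong b (λ j c → ≋-trans (Φ-cong j (F-suc c)) (Φ-⊕ j (x ◃ F c) (y ◃ E (suc c))))) (Φ-cong (suc b) F₀) ⟩
    (∑[ j + c ≐ b ] (Φ (x ◃ F c) j ⊕ Φ (y ◃ E (suc c)) j)) ⊕ Φ (y ◃ E 0) (suc b)
      ≈⟨ ≋-trans (⊕-congˡ (Φ (y ◃ E 0) (suc b)) (∑-⊕ b _ _)) (⊕-assoc (Φₜ (λ c → x ◃ F c) b) Y₊ Y₀) ⟩
    Φₜ (λ c → x ◃ F c) b ⊕ (Y₊ ⊕ Y₀)
      ≈⟨ ⊕-congʳ (Φₜ (λ c → x ◃ F c) b) (∑-last b (λ j c → Φ (y ◃ E c) j)) ⟨
    Φₜ (λ c → x ◃ F c) b ⊕ Φₜ (λ c → y ◃ E c) (suc b)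
      ≈⟨ ⊕-cong (Φₜ-◃ x F b) (Φₜ-◃ y E (suc b)) ⟩
    (φ x ⋆ Φₜ F) b ⊕ (φ y ⋆ Φₜ E) (suc b)
      ≈⟨ ⊕-cong (⋆-collapse (φ x) (Φₜ F) b (λ r → ih)) (⋆-collapse (φ y) (Φₜ E) (suc b) (λ r _ → E-constant r)) ⟩
    (φ x b ⊗ Φₜ F 0) ⊕ (φ y (suc b) ⊗ Φₜ E 0)
      ≈⟨ ⊕-cong (⊗-congʳ (φ x b) (≋-trans (Φₜ-0 F) F₀))
                (≋-trans (⊗-congʳ (φ y (suc b)) (Φₜ-0 E)) (⊗-scaleˡ (- 1ℚ) (word (x ∷ pow y (suc b))) (E 0))) ⟩
    (word (x ∷ pow y b) ⊗ (y ◃ E 0)) ⊖ (word (x ∷ pow y (suc b)) ⊗ E 0)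
      ≈⟨ ⊖-null (word-x∷yᵏ-⊗-y◃ b (E 0)) ⟩
    [] ∎
    where
    Y₊ Y₀ : Poly
    Y₊ = ∑[ j + c ≐ b ] Φ (y ◃ E (suc c)) j
    Y₀ = Φ (y ◃ E 0) (suc b)

shxy : ℕ → ℕ → Poly
shxy c a = pow x c ш pow y a

shxy-0 : ∀ c → shxy c 0 ≡ word (pow x c)
shxy-0 zero = refl
shxy-0 (suc c) = refl

shxy-suc : ∀ p b → shxy (suc p) b ≋ (∑[ i + r ≐ b ] prefix (pow y i) (x ◃ shxy p r))
shxy-suc p zero = ≡⇒≋ (sym (trans (prefix-[] (x ◃ shxy p 0)) (cong (x ◃_) (shxy-0 p))))
shxy-suc p (suc b) = ⊕-cong (≡⇒≋ (sym (prefix-[] (x ◃ shxy p (suc b))))) (begin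
  y ◃ shxy (suc p) b                                                  ≈⟨ ≡⇒≋ (◃-prefix y _) ⟩
  prefix [ y ] (shxy (suc p) b)                                       ≈⟨ prefix-cong [ y ] (shxy-suc p b) ⟩
  prefix [ y ] (∑[ i + r ≐ b ] prefix (pow y i) (x ◃ shxy p r))       ≈⟨ ∑-prefix b [ y ] _ ⟩
  ∑[ i + r ≐ b ] prefix [ y ] (prefix (pow y i) (x ◃ shxy p r))
    ≈⟨ ∑-cong b (λ i r → ≡⇒≋ (prefix-prefix [ y ] (pow y i) _)) ⟩
  ∑[ i + r ≐ b ] prefix (pow y (suc i)) (x ◃ shxy p r)                ∎)

-- The coefficients of ∑_c (xᶜ ш yᵃ) y tᶜ.
shuffleY : ℕ → Series
shuffleY a c = shxy c a ⊗ word [ y ]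

shuffleY-0-suc : ∀ c → shuffleY 0 (suc c) ≋ ((x ◃ shuffleY 0 c) ⊕ (y ◃ 𝟙 (suc c)))
shuffleY-0-suc c = begin
  word (x ∷ pow x c) ⊗ word [ y ]    ≈⟨ word-⊗ (x ∷ pow x c) (word [ y ]) ⟩
  x ◃ word (pow x c ++ [ y ])        ≈⟨ ≡⇒≋ (cong (λ t → x ◃ (t ⊗ word [ y ])) (shxy-0 c)) ⟨
  x ◃ shuffleY 0 c                   ≈⟨ ⊕-identityʳ _ ⟨
  (x ◃ shuffleY 0 c) ⊕ []            ∎

shuffleY-suc-suc : ∀ a c → shuffleY (suc a) (suc c) ≋ ((x ◃ shuffleY (suc a) c) ⊕ (y ◃ shuffleY a (suc c)))
shuffleY-suc-suc a c = ≋-trans (⊗-⊕ˡ (x ◃ shxy c (suc a)) (y ◃ shxy (suc c) a) (word [ y ]))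
  (⊕-cong (≋-sym (◃-⊗ x (shxy c (suc a)) (word [ y ]))) (≋-sym (◃-⊗ y (shxy (suc c) a) (word [ y ]))))

shuffleY-suc-0 : ∀ a → shuffleY (suc a) 0 ≋ (y ◃ shuffleY a 0)
shuffleY-suc-0 a = ≋-trans (word-⊗ (y ∷ pow y a) (word [ y ]))
  (≋-sym (≋-trans (≡⇒≋ (◃-prefix y (shuffleY a 0))) (prefix-cong [ y ] (word-⊗ (pow y a) (word [ y ])))))

ΦₜshuffleY-suc : ∀ a r → Φₜ (shuffleY a) (suc r) ≋ []
ΦₜshuffleY-suc zero = Φₜ-constant (shuffleY 0) 𝟙 ≋-refl shuffleY-0-suc Φₜ𝟙-suc
ΦₜshuffleY-suc (suc a) = Φₜ-constant (shuffleY (suc a)) (shuffleY a) (shuffleY-suc-0 a) (shuffleY-suc-suc a)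
  (ΦₜshuffleY-suc a)

ΦₜshuffleY-0 : ∀ a → Φₜ (shuffleY a) 0 ≋ word (pow y (suc a))
ΦₜshuffleY-0 a = ≋-trans (Φₜ-0 (shuffleY a))
  (≋-trans (≋-sym (word-++ (pow y a) [ y ])) (≡⇒≋ (cong word (pow-snoc y a))))

word-x∷-⊗ : ∀ u q → (word (x ∷ u) ⊗ q) ≋ (x ◃ (word u ⊗ q))
word-x∷-⊗ u q = begin
  word (x ∷ u) ⊗ q              ≈⟨ word-⊗ (x ∷ u) q ⟩
  prefix (x ∷ u) q              ≈⟨ ≡⇒≋ (prefix-prefix [ x ] u q) ⟨
  prefix [ x ] (prefix u q)     ≈⟨ prefix-cong [ x ] (word-⊗ u q) ⟨
  prefix [ x ] (word u ⊗ q)     ≈⟨ ≡⇒≋ (◃-prefix x _) ⟨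
  x ◃ (word u ⊗ q)              ∎

-- Φₜ(xᵖ⁺¹ ∑_c (xᶜ ш yᵃ) y tᶜ) = Φₜ(x)ᵖ⁺¹ yᵃ⁺¹ = ∑_b x (xᵖ ш yᵇ) yᵃ⁺¹ tᵇ
Φₜ-xpow-shuffleY : ∀ a p b → Φₜ (λ c → word (pow x (suc p)) ⊗ shuffleY a c) b ≋
                              (word [ x ] ⊗ (shxy p b ⊗ word (pow y (suc a))))
Φₜ-xpow-shuffleY a p b = begin
  Φₜ (λ c → word (pow x (suc p)) ⊗ shuffleY a c) b         ≈⟨ Φₜ-cong (λ c → word-x∷-⊗ (pow x p) (shuffleY a c)) b ⟩
  Φₜ (λ c → x ◃ (word (pow x p) ⊗ shuffleY a c)) b         ≈⟨ Φₜ-◃ x (λ c → word (pow x p) ⊗ shuffleY a c) b ⟩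
  (φ x ⋆ Φₜ (λ c → word (pow x p) ⊗ shuffleY a c)) b       ≈⟨ expand p ⟩
  word [ x ] ⊗ (shxy p b ⊗ yᵃ⁺¹)                           ∎
  where
  yᵃ⁺¹ : Poly
  yᵃ⁺¹ = word (pow y (suc a))
  xpow0 : ∀ c → (word [] ⊗ shuffleY a c) ≋ shuffleY a c
  xpow0 c = ≋-trans (word-⊗ [] (shuffleY a c)) (≡⇒≋ (prefix-[] (shuffleY a c)))
  expand : ∀ p → (φ x ⋆ Φₜ (λ c → word (pow x p) ⊗ shuffleY a c)) b ≋ (word [ x ] ⊗ (shxy p b ⊗ yᵃ⁺¹))
  expand zero = begin
    (φ x ⋆ Φₜ (λ c → word [] ⊗ shuffleY a c)) b        ≈⟨ ⋆-cong (λ i → ≋-refl {φ x i}) (Φₜ-cong xpow0) b ⟩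
    (φ x ⋆ Φₜ (shuffleY a)) b
      ≈⟨ ⋆-collapse (φ x) (Φₜ (shuffleY a)) b (λ r _ → ΦₜshuffleY-suc a r) ⟩
    word (x ∷ pow y b) ⊗ Φₜ (shuffleY a) 0              ≈⟨ ⊗-congʳ (word (x ∷ pow y b)) (ΦₜshuffleY-0 a) ⟩
    word (x ∷ pow y b) ⊗ yᵃ⁺¹
      ≈⟨ ≋-trans (⊗-congˡ yᵃ⁺¹ (word-++ [ x ] (pow y b))) (⊗-assoc (word [ x ]) (word (pow y b)) yᵃ⁺¹) ⟩
    word [ x ] ⊗ (shxy 0 b ⊗ yᵃ⁺¹)                      ∎
  expand (suc p) = begin
    ∑[ i + r ≐ b ] (word (x ∷ pow y i) ⊗ Φₜ (λ c → word (pow x (suc p)) ⊗ shuffleY a c) r)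
      ≈⟨ ∑-cong b (λ i r → ⊗-congʳ (word (x ∷ pow y i)) (Φₜ-xpow-shuffleY a p r)) ⟩
    ∑[ i + r ≐ b ] (word (x ∷ pow y i) ⊗ (word [ x ] ⊗ (shxy p r ⊗ yᵃ⁺¹)))
      ≈⟨ ∑-cong b (λ i r → x⊗prefix-x◃⊗ (pow y i) (shxy p r) yᵃ⁺¹) ⟨
    ∑[ i + r ≐ b ] (word [ x ] ⊗ (prefix (pow y i) (x ◃ shxy p r) ⊗ yᵃ⁺¹))
      ≈⟨ ≋-trans (⊗-congʳ (word [ x ]) (∑-⊗ˡ b _ yᵃ⁺¹)) (∑-⊗ʳ b (word [ x ]) _) ⟨
    word [ x ] ⊗ ((∑[ i + r ≐ b ] prefix (pow y i) (x ◃ shxy p r)) ⊗ yᵃ⁺¹)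
      ≈⟨ ⊗-congʳ (word [ x ]) (⊗-congˡ yᵃ⁺¹ (shxy-suc p b)) ⟨
    word [ x ] ⊗ (shxy (suc p) b ⊗ yᵃ⁺¹) ∎

-- Φₜ W − W collects the terms Φⱼ(W c) with j ≥ 1.
Φₜ-⊖-images : ∀ W b → (∀ c → AllWords XWordY (W c)) → InSumImages (Φₜ W b ⊖ W b)
Φₜ-⊖-images W zero W-ok = images-resp
  (≋-trans (⊕-congˡ (scale (- 1ℚ) (W 0)) (Φ-0 (W 0))) (⊖-null (≋-refl {W 0}))) images-[]
Φₜ-⊖-images W (suc b) W-ok = images-resp
  (≋-trans (⊕-congˡ (scale (- 1ℚ) (W (suc b))) (⊕-congˡ higher (Φ-0 (W (suc b))))) (⊕-⊖-cancelˡ (W (suc b)) higher))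
  (images-∑ b (λ j c → Φ (W c) (suc j)) (λ j c → Φ-suc-images (W c) j (W-ok c)))
  where
  higher : Poly
  higher = ∑[ j + c ≐ b ] Φ (W c) (suc j)

xpow-shuffleY-XWordY : ∀ a m c → AllWords XWordY (word (pow x (suc m)) ⊗ shuffleY a c)
xpow-shuffleY-XWordY a m c = XWordY-⊗ (word (pow x (suc m))) (shuffleY a c) ((pow x m , refl) ∷ [])
  (EndsWithY-⊗ (shxy c a) (word [ y ]) (([] , refl) ∷ []))

mainTheorem1 : (a b k : ℕ) → a N.+ b N.+ 2 N.≤ k → InSumImages (target a b k)
mainTheorem1 a b k a+b+2≤k = images-resp target≋ (Φₜ-⊖-images W b (xpow-shuffleY-XWordY a m))
  where
  m : ℕ
  m = k ∸ (a N.+ b N.+ 2)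
  W : Series
  W c = word (pow x (suc m)) ⊗ shuffleY a c
  k∸[a+b+1]≡1+m : k ∸ (a N.+ b N.+ 1) ≡ suc m
  k∸[a+b+1]≡1+m = trans (cong (suc k ∸_) (sym (NP.+-suc (a N.+ b) 1))) (NP.+-∸-assoc 1 a+b+2≤k)
  target≋ : target a b k ≋ (Φₜ W b ⊖ W b)
  target≋ = ⊕-cong
    (≋-trans (≡⇒≋ (cong (λ n → word [ x ] ⊗ (shxy m b ⊗ word (pow y n))) (NP.+-comm a 1)))
      (≋-sym (Φₜ-xpow-shuffleY a m b)))
    (≡⇒≋ (cong (λ n → scale (- 1ℚ) (word (pow x n) ⊗ shuffleY a b)) k∸[a+b+1]≡1+m))
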